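{- Let $n\ge2$ and let $Z_n<\mathfrak S_n$ be the cyclic group generated by the $n$-cycle $(1\,2\,\cdots\,n)$. The number of self-inverse double cosets in $Z_n\backslash\mathfrak S_n/Z_n$ is $$|\Theta^{\mathfrak S_n}_{Z_n}|=\frac1n\sum_{d\mid n}\varphi(d)\operatorname{Sq}(C_{[d^{n/d}]}),$$ where $\varphi$ is Euler's totient function.
   Context: For a subgroup $H$ of a group $G$, the inverse of the double coset $HgH$ is $Hg^{ -1}H$; $\Theta^G_H$ is the set of double cosets in $H\backslash G/H$ equal to their inverse. For a partition $\lambda$ of $n$, $C_\lambda$ is the conjugacy class of $\mathfrak S_n$ of permutations of cycle type $\lambda$, and $\operatorname{Sq}(C_\lambda)$ is the number of $x\in\mathfrak S_n$ with $x^2=g$ for any fixed $g\in C_\lambda$. $[d^{n/d}]$ is the partition with $n/d$ parts equal to $d$. -}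

module Defs where

open import Data.Nat using (ℕ; zero; suc; _+_; _*_; _<_; NonZero)
open import Data.Nat.DivMod using (_mod_)
open import Data.Nat.GCD using (gcd)
open import Data.Nat.Divisibility using (_∣?_)
open import Data.Fin using (Fin; toℕ)
import Data.Fin as F
import Data.Nat as N
open import Data.Fin.Permutation using (Permutation′; _⟨$⟩ʳ_; _⟨$⟩ˡ_)
open import Data.Vec using (Vec; []; _∷_; lookup)
open import Data.List using (List; []; _∷_; length; filter; map; concatMap; upTo; allFin)
open import Data.Bool.ListAction using (and)
open import Data.Nat.ListAction using (sum)
open import Data.Bool using (Bool; true; false; _∧_)
open import Data.Product using (Σ; ∃; ∃-syntax; _×_; _,_)
open import Relation.Nullary using (¬_; ⌊_⌋)
open import Relation.Binary.PropositionalEquality using (_≡_)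

-- The n-cycle (0 1 ... n-1) (0-indexed version of (1 2 ... n)) raised to the
-- power a: i ↦ i + a mod n.  Z_n = { rot a | a : Fin n }.
rot : (n : ℕ) .{{_ : NonZero n}} → Fin n → Fin n → Fin n
rot n a i = ((toℕ i N.+ toℕ a) mod n)

InDoubleCoset : (n : ℕ) .{{_ : NonZero n}} → (g g' : Fin n → Fin n) → Set
InDoubleCoset n g g' = ∃[ a ] ∃[ b ] (∀ i → g' i ≡ rot n a (g (rot n b i)))

-- Z_n g Z_n = Z_n g⁻¹ Z_n  (equivalently g⁻¹ ∈ Z_n g Z_n)
SelfInverse : (n : ℕ) .{{_ : NonZero n}} → Permutation′ n → Set
SelfInverse n g = InDoubleCoset n (g ⟨$⟩ʳ_) (g ⟨$⟩ˡ_)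

_InClassOf_ : ∀ {n} .{{_ : NonZero n}} → Permutation′ n → List (Permutation′ n) → Set
_InClassOf_ {n} g [] = Data.Empty.⊥ where import Data.Empty
_InClassOf_ {n} g (r ∷ rs) = InDoubleCoset n (r ⟨$⟩ʳ_) (g ⟨$⟩ʳ_) Data.Sum.⊎ (g InClassOf rs)
  where import Data.Sum

PairwiseDistinctCosets : ∀ {n} .{{_ : NonZero n}} → List (Permutation′ n) → Set
PairwiseDistinctCosets [] = Data.Unit.⊤ where import Data.Unit
PairwiseDistinctCosets (r ∷ rs) = ¬ (r InClassOf rs) × PairwiseDistinctCosets rs

IsRepSystemΘ : (n : ℕ) .{{_ : NonZero n}} → List (Permutation′ n) → Set
IsRepSystemΘ n rs =
  Data.List.Relation.Unary.All.All (SelfInverse n) rs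
  × PairwiseDistinctCosets rs
  × (∀ (g : Permutation′ n) → SelfInverse n g → g InClassOf rs)
  where import Data.List.Relation.Unary.All

iter : ∀ {n} → ℕ → (Fin n → Fin n) → Fin n → Fin n
iter zero f i = i
iter (suc k) f i = f (iter k f i)

HasCycleType-d^[n/d] : ∀ {n} → ℕ → Permutation′ n → Set
HasCycleType-d^[n/d] d g =
  ∀ i → iter d (g ⟨$⟩ʳ_) i ≡ i × (∀ j → 0 < j → j < d → ¬ (iter j (g ⟨$⟩ʳ_) i ≡ i))

allVecs : ∀ {k} (m : ℕ) → List (Vec (Fin k) m)
allVecs zero = [] ∷ []
allVecs {k} (suc m) = concatMap (λ v → map (_∷ v) (allFin k)) (allVecs m)

eqb : ∀ {n} → Fin n → Fin n → Bool
eqb i j = ⌊ i F.≟ j ⌋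

injectiveb : ∀ {n} → Vec (Fin n) n → Bool
injectiveb {n} x = and (map (λ i → and (map (λ j →
  Data.Bool.if eqb (lookup x i) (lookup x j) then eqb i j else true) (allFin n))) (allFin n))
  where import Data.Bool

isSqrtb : ∀ {n} → Permutation′ n → Vec (Fin n) n → Bool
isSqrtb {n} g x = injectiveb x ∧ and (map (λ i → eqb (lookup x (lookup x i)) (g ⟨$⟩ʳ i)) (allFin n))

Sq : ∀ {n} → Permutation′ n → ℕ
Sq {n} g = length (filter (λ x → Data.Bool.T? (isSqrtb g x)) (allVecs n))
  where import Data.Bool

φ : ℕ → ℕ
φ d = length (filter (λ k → gcd (suc k) d N.≟ 1) (upTo d))

divisors : ℕ → List ℕ
divisors n = filter (λ d → d ∣? n) (map suc (upTo n))

rhsSum : (n : ℕ) → (ℕ → Permutation′ n) → ℕ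
rhsSum n g = sum (map (λ d → φ d N.* Sq (g d)) (divisors n))

{-# OPTIONS --safe #-}
-- Write r for the n-cycle and Zₙ = ⟨r⟩. If x² = rᵉ then x⁻¹ = x r⁻ᵉ, so Zₙ x Zₙ is self-inverse;
-- conversely, if g⁻¹ = rᵃ g rᵇ then y = g rᵇ satisfies y² = rᵇ⁻ᵃ. So the self-inverse double cosets
-- are exactly those meeting Q = {x | x² ∈ Zₙ}, and each meets Q in exactly n points: for y ∈ Q the
-- map (a, b) ↦ rᵃ y rᵇ hits every point of Zₙ y Zₙ equally often, namely K = #{c | y rᶜ y ∈ Zₙ}
-- times, while rᵃ y rᵇ ∈ Q iff y rᵃ⁺ᵇ y ∈ Zₙ, which happens for n K pairs. Hence
-- n |Θ| = |Q| = ∑ₐ Sq(rᵃ). Finally rᵃ has all its cycles of length d = n / gcd(a, n), so it is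
-- conjugate to every permutation of cycle type [d^{n/d}], and exactly φ(d) residues a give this d.
module Submission where

open import Defs
open import Data.Nat using (ℕ; _≤_; _*_; NonZero)
open import Data.Nat.Divisibility using (_∣_)
open import Data.List using (List; length)
open import Data.Fin.Permutation using (Permutation′)
open import Data.Product using (∃-syntax; _×_)
open import Relation.Binary.PropositionalEquality using (_≡_)

open import Level using (Level)
open import Data.Bool using (Bool; true; false; T; if_then_else_)
open import Data.Bool.Properties using (T-∧)
open import Data.Bool.ListAction using (all)
open import Data.Nat using (zero; suc; _+_; _∸_; _/_; _<_; z≤n; s≤s; ≢-nonZero; ≢-nonZero⁻¹; >-nonZero)
import Data.Nat as ℕ
open import Data.Nat.Properties
open import Data.Nat.DivMod
open import Data.Nat.Divisibility
open import Data.Nat.GCD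
import Data.Nat.Coprimality as Coprime
open import Data.Nat.ListAction using (sum)
open import Data.Nat.ListAction.Properties using (sum-++)
open import Data.Nat.Tactic.RingSolver using (solve-∀)
open import Data.Fin using (Fin; zero; suc; toℕ; fromℕ<; cast; combine; remQuot)
import Data.Fin as Fin
import Data.Fin.Properties as Fin
open import Data.Fin.Permutation as Perm using (permutation; _⟨$⟩ʳ_; _⟨$⟩ˡ_; inverseˡ; inverseʳ)
open import Data.Vec using (Vec; []; _∷_; lookup; tabulate)
import Data.Vec.Properties as Vec
open import Data.List using ([]; _∷_; map; filter; _++_; concatMap; deduplicate; allFin; upTo)
import Data.List as List
import Data.List.Properties as List
open import Data.List.Extrema.Nat using (argmin; f[argmin]≤f[xs])
open import Data.List.Membership.Propositional using (_∈_)
open import Data.List.Membership.Propositional.Properties using (∈-allFin; ∈-filter⁺; ∈-map⁺; ∈-lookup)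
open import Data.List.Relation.Unary.All as All using (All; []; _∷_)
import Data.List.Relation.Unary.All.Properties as All
open import Data.List.Relation.Unary.Any as Any using (Any; here; there)
import Data.List.Relation.Unary.Any.Properties as Any
open import Data.List.Relation.Unary.AllPairs as AllPairs using (AllPairs; []; _∷_)
import Data.List.Relation.Unary.AllPairs.Properties as AllPairs
open import Data.List.Relation.Unary.Unique.Propositional using (Unique)
import Data.List.Relation.Unary.Unique.Propositional.Properties as Unique
open import Data.Product using (_,_; proj₁; proj₂; uncurry)
open import Data.Sum using (inj₁; inj₂)
open import Data.Unit using (tt)
open import Function using (_∘_; _⇔_; mk⇔; Equivalence)
open import Relation.Nullary using (Dec; yes; no; does; ¬_; ¬?)
open import Relation.Nullary.Decidable using (T?; map′)
open import Relation.Nullary.Negation using (contradiction)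
import Relation.Unary as U
open import Relation.Binary using (Rel; Decidable; Symmetric; Transitive; DecidableEquality)
open import Relation.Binary.Definitions using (tri<; tri≈; tri>)
open import Relation.Binary.PropositionalEquality
open import Algebra.Properties.CommutativeSemigroup +-commutativeSemigroup using () renaming (interchange to +-interchange)

private variable
  a b p : Level
  A B : Set a
  P Q : Set p

-- Finite sums over lists

∑ : List A → (A → ℕ) → ℕ
∑ xs f = sum (map f xs)

infix 5 ∑
syntax ∑ xs (λ x → e) = ∑[ x ∈ xs ] e

∑-cong : ∀ xs {f g : A → ℕ} → (∀ x → f x ≡ g x) → ∑ xs f ≡ ∑ xs g
∑-cong []       f≗g = refl
∑-cong (x ∷ xs) f≗g = cong₂ _+_ (f≗g x) (∑-cong xs f≗g)

∑-cong-All : ∀ {xs} {f g : A → ℕ} → All (λ x → f x ≡ g x) xs → ∑ xs f ≡ ∑ xs g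
∑-cong-All []          = refl
∑-cong-All (fx≡gx ∷ eqs) = cong₂ _+_ fx≡gx (∑-cong-All eqs)

∑-zero : ∀ (xs : List A) → ∑[ x ∈ xs ] 0 ≡ 0
∑-zero []       = refl
∑-zero (x ∷ xs) = ∑-zero xs

∑-const : ∀ (xs : List A) c → ∑[ x ∈ xs ] c ≡ length xs * c
∑-const []       c = refl
∑-const (x ∷ xs) c = cong (c +_) (∑-const xs c)

∑-distrib-+ : ∀ xs (f g : A → ℕ) → ∑[ x ∈ xs ] (f x + g x) ≡ ∑ xs f + ∑ xs g
∑-distrib-+ []       f g = refl
∑-distrib-+ (x ∷ xs) f g = trans (cong (f x + g x +_) (∑-distrib-+ xs f g)) (+-interchange (f x) (g x) (∑ xs f) (∑ xs g))

*-distribˡ-∑ : ∀ c xs (f : A → ℕ) → c * ∑ xs f ≡ ∑[ x ∈ xs ] c * f x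
*-distribˡ-∑ c []       f = *-zeroʳ c
*-distribˡ-∑ c (x ∷ xs) f = trans (*-distribˡ-+ c (f x) _) (cong (c * f x +_) (*-distribˡ-∑ c xs f))

*-distribʳ-∑ : ∀ c xs (f : A → ℕ) → ∑ xs f * c ≡ ∑[ x ∈ xs ] f x * c
*-distribʳ-∑ c xs f = trans (*-comm _ c) (trans (*-distribˡ-∑ c xs f) (∑-cong xs λ x → *-comm c (f x)))

∑-comm : ∀ (xs : List A) (ys : List B) (f : A → B → ℕ) →
         ∑[ x ∈ xs ] ∑[ y ∈ ys ] f x y ≡ ∑[ y ∈ ys ] ∑[ x ∈ xs ] f x y
∑-comm []       ys f = sym (∑-zero ys)
∑-comm (x ∷ xs) ys f = trans (cong (∑ ys (f x) +_) (∑-comm xs ys f))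
                             (sym (∑-distrib-+ ys (f x) (λ y → ∑[ x ∈ xs ] f x y)))

∑-map : ∀ (h : A → B) xs (f : B → ℕ) → ∑ (map h xs) f ≡ ∑[ x ∈ xs ] f (h x)
∑-map h []       f = refl
∑-map h (x ∷ xs) f = cong (f (h x) +_) (∑-map h xs f)

∑-++ : ∀ (xs ys : List A) f → ∑ (xs ++ ys) f ≡ ∑ xs f + ∑ ys f
∑-++ xs ys f = trans (cong sum (List.map-++ f xs ys)) (sum-++ (map f xs) (map f ys))

∑-concatMap : ∀ (h : A → List B) xs f → ∑ (concatMap h xs) f ≡ ∑[ x ∈ xs ] ∑ (h x) f
∑-concatMap h []       f = refl
∑-concatMap h (x ∷ xs) f = trans (∑-++ (h x) _ f) (cong (∑ (h x) f +_) (∑-concatMap h xs f))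

𝟙 : Dec P → ℕ
𝟙 P? = if does P? then 1 else 0

𝟙-yes : (P? : Dec P) → P → 𝟙 P? ≡ 1
𝟙-yes (yes _) _  = refl
𝟙-yes (no ¬p) p = contradiction p ¬p

𝟙-no : (P? : Dec P) → ¬ P → 𝟙 P? ≡ 0
𝟙-no (yes p) ¬p = contradiction p ¬p
𝟙-no (no _)  _  = refl

𝟙-mono : (P? : Dec P) (Q? : Dec Q) → (P → Q) → 𝟙 P? ≤ 𝟙 Q?
𝟙-mono (yes p) (yes _) _   = ≤-refl
𝟙-mono (yes p) (no ¬q) P⇒Q = contradiction (P⇒Q p) ¬q
𝟙-mono (no _)  _       _   = z≤n

𝟙-cong : (P? : Dec P) (Q? : Dec Q) → (P → Q) → (Q → P) → 𝟙 P? ≡ 𝟙 Q?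
𝟙-cong P? Q? P⇒Q Q⇒P = ≤-antisym (𝟙-mono P? Q? P⇒Q) (𝟙-mono Q? P? Q⇒P)

length-filter : {P : U.Pred A p} (P? : U.Decidable P) → ∀ xs → length (filter P? xs) ≡ ∑[ x ∈ xs ] 𝟙 (P? x)
length-filter P? []       = refl
length-filter P? (x ∷ xs) with does (P? x)
... | true  = cong suc (length-filter P? xs)
... | false = length-filter P? xs

∑-filter : {P : U.Pred A p} (P? : U.Decidable P) → ∀ xs f → ∑ (filter P? xs) f ≡ ∑[ x ∈ xs ] 𝟙 (P? x) * f x
∑-filter P? []       f = refl
∑-filter P? (x ∷ xs) f with does (P? x)
... | true  = cong₂ _+_ (sym (+-identityʳ (f x))) (∑-filter P? xs f)
... | false = ∑-filter P? xs f

∑-𝟙-none : {P : U.Pred A p} (P? : U.Decidable P) → ∀ {xs} → All (¬_ ∘ P) xs → ∑[ x ∈ xs ] 𝟙 (P? x) ≡ 0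
∑-𝟙-none P? {xs} none = trans (sym (length-filter P? xs)) (cong length (List.filter-none P? none))

record IsEnumeration {A : Set a} (_≟_ : DecidableEquality A) (xs : List A) : Set a where
  field count≡1 : ∀ x → ∑[ y ∈ xs ] 𝟙 (x ≟ y) ≡ 1
open IsEnumeration public

module _ {A : Set a} (_≟_ : DecidableEquality A) (xs : List A) (x : A) (once : ∑[ y ∈ xs ] 𝟙 (x ≟ y) ≡ 1) where

  ∑-δ : ∀ (f : A → ℕ) → ∑[ y ∈ xs ] 𝟙 (x ≟ y) * f y ≡ f x
  ∑-δ f = begin
    ∑[ y ∈ xs ] 𝟙 (x ≟ y) * f y   ≡⟨ ∑-cong xs (λ y → δ-* y) ⟩
    ∑[ y ∈ xs ] 𝟙 (x ≟ y) * f x   ≡⟨ *-distribʳ-∑ (f x) xs (λ y → 𝟙 (x ≟ y)) ⟨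
    (∑[ y ∈ xs ] 𝟙 (x ≟ y)) * f x ≡⟨ cong (_* f x) once ⟩
    1 * f x                       ≡⟨ *-identityˡ (f x) ⟩
    f x                           ∎
    where
    open ≡-Reasoning
    δ-* : ∀ y → 𝟙 (x ≟ y) * f y ≡ 𝟙 (x ≟ y) * f x
    δ-* y with x ≟ y
    ... | yes refl = refl
    ... | no _     = refl

  ∈-counted-once : x ∈ xs
  ∈-counted-once = go xs (≤-reflexive (sym once))
    where
    go : ∀ ys → 1 ≤ ∑[ y ∈ ys ] 𝟙 (x ≟ y) → x ∈ ys
    go (y ∷ ys) 1≤∑ with x ≟ y
    ... | yes refl = here refl
    ... | no _     = there (go ys 1≤∑)

module _ {A : Set a} {B : Set b} {_≟ᴬ_ : DecidableEquality A} {_≟ᴮ_ : DecidableEquality B} where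

  ∑-reindex : ∀ {xs ys} → IsEnumeration _≟ᴬ_ xs → IsEnumeration _≟ᴮ_ ys →
              (σ : A → B) (τ : B → A) → (∀ x → τ (σ x) ≡ x) → (∀ y → σ (τ y) ≡ y) →
              (f : B → ℕ) → ∑[ x ∈ xs ] f (σ x) ≡ ∑ ys f
  ∑-reindex {xs} {ys} enumᴬ enumᴮ σ τ τσ στ f = begin
    ∑[ x ∈ xs ] f (σ x)                             ≡⟨ ∑-cong xs (λ x → ∑-δ _≟ᴮ_ ys (σ x) (count≡1 enumᴮ (σ x)) f) ⟨
    ∑[ x ∈ xs ] ∑[ y ∈ ys ] 𝟙 (σ x ≟ᴮ y) * f y       ≡⟨ ∑-comm xs ys _ ⟩
    ∑[ y ∈ ys ] ∑[ x ∈ xs ] 𝟙 (σ x ≟ᴮ y) * f y       ≡⟨ ∑-cong ys (λ y → ∑-cong xs (λ x → cong (_* f y) (δ-transpose x y))) ⟩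
    ∑[ y ∈ ys ] ∑[ x ∈ xs ] 𝟙 (τ y ≟ᴬ x) * f y       ≡⟨ ∑-cong ys (λ y → *-distribʳ-∑ (f y) xs (λ x → 𝟙 (τ y ≟ᴬ x))) ⟨
    ∑[ y ∈ ys ] (∑[ x ∈ xs ] 𝟙 (τ y ≟ᴬ x)) * f y     ≡⟨ ∑-cong ys (λ y → trans (cong (_* f y) (count≡1 enumᴬ (τ y))) (*-identityˡ (f y))) ⟩
    ∑ ys f                                          ∎
    where
    open ≡-Reasoning
    δ-transpose : ∀ x y → 𝟙 (σ x ≟ᴮ y) ≡ 𝟙 (τ y ≟ᴬ x)
    δ-transpose x y = 𝟙-cong (σ x ≟ᴮ y) (τ y ≟ᴬ x) (λ { refl → τσ x }) (λ { refl → στ y })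

∑-allFin-suc : ∀ n (h : Fin (suc n) → ℕ) → ∑ (allFin (suc n)) h ≡ h zero + (∑[ i ∈ allFin n ] h (suc i))
∑-allFin-suc n h = cong (λ hs → h zero + sum hs) (trans (List.map-tabulate suc h) (sym (List.map-tabulate (λ i → i) (h ∘ suc))))

∑-allFin-const : ∀ n c → ∑[ i ∈ allFin n ] c ≡ n * c
∑-allFin-const n c = trans (∑-const (allFin n) c) (cong (_* c) (List.length-tabulate {n = n} (λ i → i)))

allFin-isEnumeration : ∀ n → IsEnumeration Fin._≟_ (allFin n)
allFin-isEnumeration n = record { count≡1 = count n }
  where
  open ≡-Reasoning
  count : ∀ n (i : Fin n) → ∑[ j ∈ allFin n ] 𝟙 (i Fin.≟ j) ≡ 1
  count (suc n) zero    = begin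
    ∑[ j ∈ allFin (suc n) ] 𝟙 (zero Fin.≟ j)   ≡⟨ ∑-allFin-suc n (λ j → 𝟙 (zero Fin.≟ j)) ⟩
    1 + (∑[ j ∈ allFin n ] 𝟙 (zero Fin.≟ suc j)) ≡⟨ cong suc (∑-cong (allFin n) (λ j → 𝟙-no (zero Fin.≟ suc j) λ ())) ⟩
    1 + (∑[ j ∈ allFin n ] 0)                  ≡⟨ cong suc (∑-zero (allFin n)) ⟩
    1                                          ∎
  count (suc n) (suc i) = begin
    ∑[ j ∈ allFin (suc n) ] 𝟙 (suc i Fin.≟ j)   ≡⟨ ∑-allFin-suc n (λ j → 𝟙 (suc i Fin.≟ j)) ⟩
    0 + (∑[ j ∈ allFin n ] 𝟙 (suc i Fin.≟ suc j)) ≡⟨ ∑-cong (allFin n) (λ j → 𝟙-cong (suc i Fin.≟ suc j) (i Fin.≟ j) Fin.suc-injective (cong suc)) ⟩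
    ∑[ j ∈ allFin n ] 𝟙 (i Fin.≟ j)             ≡⟨ count n i ⟩
    1                                           ∎

∑-upTo-suc : ∀ n (h : ℕ → ℕ) → ∑ (upTo (suc n)) h ≡ h 0 + (∑[ x ∈ upTo n ] h (suc x))
∑-upTo-suc n h = cong (h 0 +_) (trans (cong (λ xs → ∑ xs h) (sym (List.map-upTo suc n))) (∑-map suc (upTo n) h))

∑-upTo-last : ∀ n (h : ℕ → ℕ) → ∑ (upTo (suc n)) h ≡ ∑ (upTo n) h + h n
∑-upTo-last n h = trans (cong (λ xs → ∑ xs h) (sym (List.upTo-∷ʳ n))) (trans (∑-++ (upTo n) (n ∷ []) h) (cong (∑ (upTo n) h +_) (+-identityʳ (h n))))

∑-upTo-+ : ∀ a b (h : ℕ → ℕ) → ∑ (upTo (a + b)) h ≡ ∑ (upTo a) h + (∑[ x ∈ upTo b ] h (a + x))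
∑-upTo-+ zero    b h = refl
∑-upTo-+ (suc a) b h = begin
  ∑ (upTo (suc (a + b))) h                                             ≡⟨ ∑-upTo-suc (a + b) h ⟩
  h 0 + (∑[ x ∈ upTo (a + b) ] h (suc x))                              ≡⟨ cong (h 0 +_) (∑-upTo-+ a b (h ∘ suc)) ⟩
  h 0 + ((∑[ x ∈ upTo a ] h (suc x)) + (∑[ x ∈ upTo b ] h (suc a + x))) ≡⟨ +-assoc (h 0) _ _ ⟨
  h 0 + (∑[ x ∈ upTo a ] h (suc x)) + (∑[ x ∈ upTo b ] h (suc a + x)) ≡⟨ cong (_+ (∑[ x ∈ upTo b ] h (suc a + x))) (∑-upTo-suc a h) ⟨
  ∑ (upTo (suc a)) h + (∑[ x ∈ upTo b ] h (suc a + x))                 ∎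
  where open ≡-Reasoning

∑-upTo-* : ∀ d m (h : ℕ → ℕ) → ∑ (upTo (d * m)) h ≡ ∑[ q ∈ upTo d ] ∑[ r ∈ upTo m ] h (q * m + r)
∑-upTo-* zero    m h = refl
∑-upTo-* (suc d) m h = begin
  ∑ (upTo (m + d * m)) h                                                       ≡⟨ ∑-upTo-+ m (d * m) h ⟩
  ∑ (upTo m) h + (∑[ x ∈ upTo (d * m) ] h (m + x))                             ≡⟨ cong (∑ (upTo m) h +_) (∑-upTo-* d m (λ x → h (m + x))) ⟩
  ∑ (upTo m) h + (∑[ q ∈ upTo d ] ∑[ r ∈ upTo m ] h (m + (q * m + r)))         ≡⟨ cong (∑ (upTo m) h +_) (∑-cong (upTo d) λ q → ∑-cong (upTo m) λ r → cong h (sym (+-assoc m (q * m) r))) ⟩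
  ∑ (upTo m) h + (∑[ q ∈ upTo d ] ∑[ r ∈ upTo m ] h (suc q * m + r))           ≡⟨ ∑-upTo-suc d (λ q → ∑[ r ∈ upTo m ] h (q * m + r)) ⟨
  ∑[ q ∈ upTo (suc d) ] ∑[ r ∈ upTo m ] h (q * m + r)                          ∎
  where open ≡-Reasoning

∑-upTo≡∑-allFin : ∀ n (h : ℕ → ℕ) → ∑ (upTo n) h ≡ ∑[ a ∈ allFin n ] h (toℕ a)
∑-upTo≡∑-allFin zero    h = refl
∑-upTo≡∑-allFin (suc n) h = begin
  ∑ (upTo (suc n)) h                            ≡⟨ ∑-upTo-suc n h ⟩
  h 0 + (∑[ x ∈ upTo n ] h (suc x))             ≡⟨ cong (h 0 +_) (∑-upTo≡∑-allFin n (h ∘ suc)) ⟩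
  h 0 + (∑[ a ∈ allFin n ] h (suc (toℕ a)))     ≡⟨ ∑-allFin-suc n (h ∘ toℕ) ⟨
  ∑[ a ∈ allFin (suc n) ] h (toℕ a)             ∎
  where open ≡-Reasoning

∑-upTo-𝟙[c≟x]≡1 : ∀ {n c} → c < n → ∑[ x ∈ upTo n ] 𝟙 (c ℕ.≟ x) ≡ 1
∑-upTo-𝟙[c≟x]≡1 {n} {c} c<n = begin
  ∑[ x ∈ upTo n ] 𝟙 (c ℕ.≟ x)                ≡⟨ ∑-upTo≡∑-allFin n (λ x → 𝟙 (c ℕ.≟ x)) ⟩
  ∑[ a ∈ allFin n ] 𝟙 (c ℕ.≟ toℕ a)          ≡⟨ ∑-cong (allFin n) (λ a → 𝟙-cong (c ℕ.≟ toℕ a) (fromℕ< c<n Fin.≟ a)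
                                                   (λ { refl → Fin.toℕ-injective (Fin.toℕ-fromℕ< c<n) }) (λ { refl → sym (Fin.toℕ-fromℕ< c<n) })) ⟩
  ∑[ a ∈ allFin n ] 𝟙 (fromℕ< c<n Fin.≟ a)   ≡⟨ count≡1 (allFin-isEnumeration n) (fromℕ< c<n) ⟩
  1                                          ∎
  where open ≡-Reasoning

_≟ᵛ_ : ∀ {c m} → DecidableEquality (Vec (Fin c) m)
_≟ᵛ_ = Vec.≡-dec Fin._≟_

allVecs-isEnumeration : ∀ {c} m → IsEnumeration (_≟ᵛ_ {c} {m}) (allVecs m)
allVecs-isEnumeration {c} m = record { count≡1 = count m }
  where
  open ≡-Reasoning
  δᵛ : ∀ {m} → Vec (Fin c) m → Vec (Fin c) m → ℕ
  δᵛ v w = 𝟙 (v ≟ᵛ w)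
  δᶠ : Fin c → Fin c → ℕ
  δᶠ x y = 𝟙 (x Fin.≟ y)
  δᵛ-∷ : ∀ {m} x y (v w : Vec (Fin c) m) → δᵛ (x ∷ v) (y ∷ w) ≡ δᶠ x y * δᵛ v w
  δᵛ-∷ x y v w with x Fin.≟ y | v ≟ᵛ w
  ... | yes refl | yes refl = refl
  ... | yes refl | no _     = refl
  ... | no _     | _        = refl
  count : ∀ m (v : Vec (Fin c) m) → ∑[ w ∈ allVecs m ] δᵛ v w ≡ 1
  count zero    []      = refl
  count (suc m) (x ∷ v) = begin
    ∑[ w′ ∈ allVecs (suc m) ] δᵛ (x ∷ v) w′                         ≡⟨ ∑-concatMap (λ w → map (_∷ w) (allFin c)) (allVecs m) _ ⟩
    ∑[ w ∈ allVecs m ] ∑ (map (_∷ w) (allFin c)) (δᵛ (x ∷ v))      ≡⟨ ∑-cong (allVecs m) (λ w → ∑-map (_∷ w) (allFin c) _) ⟩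
    ∑[ w ∈ allVecs m ] ∑[ y ∈ allFin c ] δᵛ (x ∷ v) (y ∷ w)        ≡⟨ ∑-cong (allVecs m) (λ w → ∑-cong (allFin c) (λ y → δᵛ-∷ x y v w)) ⟩
    ∑[ w ∈ allVecs m ] ∑[ y ∈ allFin c ] δᶠ x y * δᵛ v w           ≡⟨ ∑-cong (allVecs m) (λ w → *-distribʳ-∑ (δᵛ v w) (allFin c) (δᶠ x)) ⟨
    ∑[ w ∈ allVecs m ] ∑ (allFin c) (δᶠ x) * δᵛ v w                ≡⟨ ∑-cong (allVecs m) (λ w → cong (_* δᵛ v w) (count≡1 (allFin-isEnumeration c) x)) ⟩
    ∑[ w ∈ allVecs m ] 1 * δᵛ v w                                  ≡⟨ ∑-cong (allVecs m) (λ w → *-identityˡ (δᵛ v w)) ⟩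
    ∑[ w ∈ allVecs m ] δᵛ v w                                      ≡⟨ count m v ⟩
    1                                                              ∎

-- Square roots of permutations

T-all-allFin : ∀ {n} (p : Fin n → Bool) → T (all p (allFin n)) ⇔ (∀ i → T (p i))
T-all-allFin {n} p = mk⇔ (All.tabulate⁻ ∘ All.all⁺ p (allFin n)) (All.all⁻ p ∘ All.tabulate⁺)

T-eqb : ∀ {n} {i j : Fin n} → T (eqb i j) ⇔ i ≡ j
T-eqb {i = i} {j} with i Fin.≟ j
... | yes i≡j = mk⇔ (λ _ → i≡j) _
... | no  i≢j = mk⇔ (λ ()) i≢j

IsSquareRoot : ∀ {n} → (Fin n → Fin n) → Vec (Fin n) n → Set
IsSquareRoot f x = ∀ i → lookup x (lookup x i) ≡ f i

isSquareRoot? : ∀ {n} (f : Fin n → Fin n) x → Dec (IsSquareRoot f x)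
isSquareRoot? f x = Fin.all? (λ i → lookup x (lookup x i) Fin.≟ f i)

squareRoot-injective : ∀ {n} (g : Permutation′ n) {x} → IsSquareRoot (g ⟨$⟩ʳ_) x →
                       ∀ {i j} → lookup x i ≡ lookup x j → i ≡ j
squareRoot-injective g {x} x²≡g {i} {j} xi≡xj = begin
  i                           ≡⟨ inverseˡ g ⟨
  g ⟨$⟩ˡ (g ⟨$⟩ʳ i)           ≡⟨ cong (g ⟨$⟩ˡ_) (trans (sym (x²≡g i)) (trans (cong (lookup x) xi≡xj) (x²≡g j))) ⟩
  g ⟨$⟩ˡ (g ⟨$⟩ʳ j)           ≡⟨ inverseˡ g ⟩
  j                           ∎
  where open ≡-Reasoning

-- The injectivity conjunct of isSqrtb is redundant: x ∘ x = g already forces x to be injective.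
isSqrtb⇔IsSquareRoot : ∀ {n} (g : Permutation′ n) x → T (isSqrtb g x) ⇔ IsSquareRoot (g ⟨$⟩ʳ_) x
isSqrtb⇔IsSquareRoot g x = mk⇔
  (λ t i → Equivalence.to T-eqb (Equivalence.to (T-all-allFin _) (proj₂ (Equivalence.to T-∧ t)) i))
  (λ x²≡g → Equivalence.from T-∧ (injective x²≡g , Equivalence.from (T-all-allFin _) (λ i → Equivalence.from T-eqb (x²≡g i))))
  where
  injective : IsSquareRoot (g ⟨$⟩ʳ_) x → T (injectiveb x)
  injective x²≡g = Equivalence.from (T-all-allFin _) λ i → Equivalence.from (T-all-allFin _) λ j → implication i j
    where
    implication : ∀ i j → T (if eqb (lookup x i) (lookup x j) then eqb i j else true)
    implication i j with lookup x i Fin.≟ lookup x j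
    ... | yes xi≡xj = Equivalence.from T-eqb (squareRoot-injective g {x} x²≡g xi≡xj)
    ... | no  _     = _

Sq≡∑-isSquareRoot : ∀ {n} (g : Permutation′ n) → Sq g ≡ ∑[ x ∈ allVecs n ] 𝟙 (isSquareRoot? (g ⟨$⟩ʳ_) x)
Sq≡∑-isSquareRoot {n} g = trans (length-filter (λ x → T? (isSqrtb g x)) (allVecs n))
  (∑-cong (allVecs n) λ x → 𝟙-cong (T? (isSqrtb g x)) (isSquareRoot? _ x)
    (Equivalence.to (isSqrtb⇔IsSquareRoot g x)) (Equivalence.from (isSqrtb⇔IsSquareRoot g x)))

lookup-injective : ∀ {a} {A : Set a} {n} {v w : Vec A n} → (∀ i → lookup v i ≡ lookup w i) → v ≡ w
lookup-injective {v = v} {w} v≗w = trans (sym (Vec.tabulate∘lookup v)) (trans (Vec.tabulate-cong v≗w) (Vec.tabulate∘lookup w))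

module VecConjugation {n} (σ : Permutation′ n) where

  private
    s s⁻¹ : Fin n → Fin n
    s   i = σ ⟨$⟩ʳ i
    s⁻¹ i = σ ⟨$⟩ˡ i

  conj conj⁻¹ : Vec (Fin n) n → Vec (Fin n) n
  conj   x = tabulate (λ i → s (lookup x (s⁻¹ i)))
  conj⁻¹ y = tabulate (λ i → s⁻¹ (lookup y (s i)))

  conj⁻¹∘conj : ∀ x → conj⁻¹ (conj x) ≡ x
  conj⁻¹∘conj x = lookup-injective λ i → begin
    lookup (conj⁻¹ (conj x)) i          ≡⟨ Vec.lookup∘tabulate _ i ⟩
    s⁻¹ (lookup (conj x) (s i))         ≡⟨ cong s⁻¹ (Vec.lookup∘tabulate _ (s i)) ⟩
    s⁻¹ (s (lookup x (s⁻¹ (s i))))      ≡⟨ inverseˡ σ ⟩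
    lookup x (s⁻¹ (s i))                ≡⟨ cong (lookup x) (inverseˡ σ) ⟩
    lookup x i                          ∎
    where open ≡-Reasoning

  conj∘conj⁻¹ : ∀ y → conj (conj⁻¹ y) ≡ y
  conj∘conj⁻¹ y = lookup-injective λ i → begin
    lookup (conj (conj⁻¹ y)) i          ≡⟨ Vec.lookup∘tabulate _ i ⟩
    s (lookup (conj⁻¹ y) (s⁻¹ i))       ≡⟨ cong s (Vec.lookup∘tabulate _ (s⁻¹ i)) ⟩
    s (s⁻¹ (lookup y (s (s⁻¹ i))))      ≡⟨ inverseʳ σ ⟩
    lookup y (s (s⁻¹ i))                ≡⟨ cong (lookup y) (inverseʳ σ) ⟩
    lookup y i                          ∎
    where open ≡-Reasoning

  conj-square : ∀ x i → lookup (conj x) (lookup (conj x) i) ≡ s (lookup x (lookup x (s⁻¹ i)))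
  conj-square x i = begin
    lookup (conj x) (lookup (conj x) i)       ≡⟨ Vec.lookup∘tabulate (λ j → s (lookup x (s⁻¹ j))) _ ⟩
    s (lookup x (s⁻¹ (lookup (conj x) i)))    ≡⟨ cong (λ j → s (lookup x (s⁻¹ j))) (Vec.lookup∘tabulate _ i) ⟩
    s (lookup x (s⁻¹ (s (lookup x (s⁻¹ i))))) ≡⟨ cong (s ∘ lookup x) (inverseˡ σ) ⟩
    s (lookup x (lookup x (s⁻¹ i)))           ∎
    where open ≡-Reasoning

  conj-isSquareRoot⇔ : ∀ {p p′ : Permutation′ n} → (∀ i → σ ⟨$⟩ʳ (p ⟨$⟩ʳ i) ≡ p′ ⟨$⟩ʳ (σ ⟨$⟩ʳ i)) →
                       ∀ x → IsSquareRoot (p ⟨$⟩ʳ_) x ⇔ IsSquareRoot (p′ ⟨$⟩ʳ_) (conj x)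
  conj-isSquareRoot⇔ {p} {p′} σp≗p′σ x = mk⇔
    (λ x²≗p i → begin
      lookup (conj x) (lookup (conj x) i)   ≡⟨ conj-square x i ⟩
      s (lookup x (lookup x (s⁻¹ i)))       ≡⟨ cong s (x²≗p (s⁻¹ i)) ⟩
      s (p ⟨$⟩ʳ s⁻¹ i)                      ≡⟨ σp≗p′σ (s⁻¹ i) ⟩
      p′ ⟨$⟩ʳ s (s⁻¹ i)                     ≡⟨ cong (p′ ⟨$⟩ʳ_) (inverseʳ σ) ⟩
      p′ ⟨$⟩ʳ i                             ∎)
    (λ y²≗p′ i → begin
      lookup x (lookup x i)                 ≡⟨ inverseˡ σ ⟨
      s⁻¹ (s (lookup x (lookup x i)))       ≡⟨ cong (λ j → s⁻¹ (s (lookup x (lookup x j)))) (inverseˡ σ) ⟨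
      s⁻¹ (s (lookup x (lookup x (s⁻¹ (s i))))) ≡⟨ cong s⁻¹ (conj-square x (s i)) ⟨
      s⁻¹ (lookup (conj x) (lookup (conj x) (s i))) ≡⟨ cong s⁻¹ (y²≗p′ (s i)) ⟩
      s⁻¹ (p′ ⟨$⟩ʳ s i)                     ≡⟨ cong s⁻¹ (σp≗p′σ i) ⟨
      s⁻¹ (s (p ⟨$⟩ʳ i))                    ≡⟨ inverseˡ σ ⟩
      p ⟨$⟩ʳ i                              ∎)
    where open ≡-Reasoning

Sq-conjugate : ∀ {n} (σ : Permutation′ n) {p p′ : Permutation′ n} →
               (∀ i → σ ⟨$⟩ʳ (p ⟨$⟩ʳ i) ≡ p′ ⟨$⟩ʳ (σ ⟨$⟩ʳ i)) → Sq p ≡ Sq p′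
Sq-conjugate {n} σ {p} {p′} σp≗p′σ = begin
  Sq p                                                          ≡⟨ Sq≡∑-isSquareRoot p ⟩
  ∑[ x ∈ allVecs n ] 𝟙 (isSquareRoot? (p ⟨$⟩ʳ_) x)              ≡⟨ ∑-cong (allVecs n) (λ x → 𝟙-cong (isSquareRoot? (p ⟨$⟩ʳ_) x) (isSquareRoot? (p′ ⟨$⟩ʳ_) (conj x))
                                                                     (Equivalence.to (conj-isSquareRoot⇔ {p} {p′} σp≗p′σ x)) (Equivalence.from (conj-isSquareRoot⇔ {p} {p′} σp≗p′σ x))) ⟩
  ∑[ x ∈ allVecs n ] 𝟙 (isSquareRoot? (p′ ⟨$⟩ʳ_) (conj x))      ≡⟨ ∑-reindex (allVecs-isEnumeration n) (allVecs-isEnumeration n)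
                                                                     conj conj⁻¹ conj⁻¹∘conj conj∘conj⁻¹ (λ y → 𝟙 (isSquareRoot? (p′ ⟨$⟩ʳ_) y)) ⟩
  ∑[ y ∈ allVecs n ] 𝟙 (isSquareRoot? (p′ ⟨$⟩ʳ_) y)             ≡⟨ Sq≡∑-isSquareRoot p′ ⟨
  Sq p′                                                         ∎
  where
  open ≡-Reasoning
  open VecConjugation σ

module _ {A : Set a} {ℓ : Level} {_∼_ : Rel A ℓ} (_∼?_ : Decidable _∼_) where

  deduplicate-pairwise : ∀ xs → AllPairs (λ x y → ¬ x ∼ y) (deduplicate _∼?_ xs)
  deduplicate-pairwise []       = []
  deduplicate-pairwise (x ∷ xs) = All.all-filter (¬? ∘ (x ∼?_)) (deduplicate _∼?_ xs) ∷ AllPairs.filter⁺ _ (deduplicate-pairwise xs)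

  deduplicate-covers : Transitive _∼_ → ∀ {z xs} → Any (_∼ z) xs → Any (_∼ z) (deduplicate _∼?_ xs)
  deduplicate-covers ∼-trans = Any.deduplicate⁺ _∼?_ ∼-trans

  module _ (∼-sym : Symmetric _∼_) (∼-trans : Transitive _∼_) where

    ≁-classes-disjoint : ∀ {r rs x} → All (λ s → ¬ r ∼ s) rs → r ∼ x → All (λ s → ¬ s ∼ x) rs
    ≁-classes-disjoint r≁rs r∼x = All.map (λ r≁s s∼x → r≁s (∼-trans r∼x (∼-sym s∼x))) r≁rs

    ∑-𝟙-representatives : ∀ {rs x} → AllPairs (λ r s → ¬ r ∼ s) rs → Any (_∼ x) rs → ∑[ r ∈ rs ] 𝟙 (r ∼? x) ≡ 1
    ∑-𝟙-representatives (r≁rs ∷ _)  (here r∼x)  = cong₂ _+_ (𝟙-yes (_ ∼? _) r∼x) (∑-𝟙-none (_∼? _) (≁-classes-disjoint r≁rs r∼x))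
    ∑-𝟙-representatives (r≁rs ∷ pw) (there s∼x) =
      cong₂ _+_ (𝟙-no (_ ∼? _) λ r∼x → All.All¬⇒¬Any (≁-classes-disjoint r≁rs r∼x) s∼x) (∑-𝟙-representatives pw s∼x)

[m%d+n]%d≡[m+n]%d : ∀ m n d .{{_ : NonZero d}} → (m % d + n) % d ≡ (m + n) % d
[m%d+n]%d≡[m+n]%d m n d = trans (%-distribˡ-+ (m % d) n d)
  (trans (cong (λ x → (x + n % d) % d) (m%n%n≡m%n m d)) (sym (%-distribˡ-+ m n d)))

[m+n%d]%d≡[m+n]%d : ∀ m n d .{{_ : NonZero d}} → (m + n % d) % d ≡ (m + n) % d
[m+n%d]%d≡[m+n]%d m n d = trans (cong (_% d) (+-comm m (n % d)))
  (trans ([m%d+n]%d≡[m+n]%d n m d) (cong (_% d) (+-comm n m)))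

module Rotations (k : ℕ) where

  N : ℕ
  N = suc k

  infixl 6 _⊕_
  infix 8 ⊖_

  toℕ-mod : ∀ m → toℕ (m mod N) ≡ m % N
  toℕ-mod m = Fin.toℕ-fromℕ< (m%n<n m N)

  opaque
    _⊕_ : Fin N → Fin N → Fin N
    i ⊕ a = rot N a i

    ⊖_ : Fin N → Fin N
    ⊖ a = (N ∸ toℕ a) mod N

    ⊕≡rot : ∀ i a → i ⊕ a ≡ rot N a i
    ⊕≡rot i a = refl

    toℕ-⊕ : ∀ i a → toℕ (i ⊕ a) ≡ (toℕ i + toℕ a) % N
    toℕ-⊕ i a = toℕ-mod (toℕ i + toℕ a)

    toℕ-⊖ : ∀ a → toℕ (⊖ a) ≡ (N ∸ toℕ a) % N
    toℕ-⊖ a = toℕ-mod (N ∸ toℕ a)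

  toℕ%N : ∀ (i : Fin N) → toℕ i % N ≡ toℕ i
  toℕ%N i = m<n⇒m%n≡m (Fin.toℕ<n i)

  ⊕-comm : ∀ i j → i ⊕ j ≡ j ⊕ i
  ⊕-comm i j = Fin.toℕ-injective (trans (toℕ-⊕ i j) (trans (cong (_% N) (+-comm (toℕ i) (toℕ j))) (sym (toℕ-⊕ j i))))

  ⊕-assoc : ∀ i j l → i ⊕ j ⊕ l ≡ i ⊕ (j ⊕ l)
  ⊕-assoc i j l = Fin.toℕ-injective (begin
    toℕ (i ⊕ j ⊕ l)                    ≡⟨ toℕ-⊕ (i ⊕ j) l ⟩
    (toℕ (i ⊕ j) + toℕ l) % N          ≡⟨ cong (λ x → (x + toℕ l) % N) (toℕ-⊕ i j) ⟩
    ((toℕ i + toℕ j) % N + toℕ l) % N  ≡⟨ [m%d+n]%d≡[m+n]%d (toℕ i + toℕ j) (toℕ l) N ⟩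
    (toℕ i + toℕ j + toℕ l) % N        ≡⟨ cong (_% N) (+-assoc (toℕ i) (toℕ j) (toℕ l)) ⟩
    (toℕ i + (toℕ j + toℕ l)) % N      ≡⟨ [m+n%d]%d≡[m+n]%d (toℕ i) (toℕ j + toℕ l) N ⟨
    (toℕ i + (toℕ j + toℕ l) % N) % N  ≡⟨ cong (λ x → (toℕ i + x) % N) (toℕ-⊕ j l) ⟨
    (toℕ i + toℕ (j ⊕ l)) % N          ≡⟨ toℕ-⊕ i (j ⊕ l) ⟨
    toℕ (i ⊕ (j ⊕ l))                  ∎)
    where open ≡-Reasoning

  ⊕-identityʳ : ∀ i → i ⊕ zero ≡ i
  ⊕-identityʳ i = Fin.toℕ-injective (trans (toℕ-⊕ i zero) (trans (cong (_% N) (+-identityʳ (toℕ i))) (toℕ%N i)))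

  ⊕-identityˡ : ∀ i → zero ⊕ i ≡ i
  ⊕-identityˡ i = trans (⊕-comm zero i) (⊕-identityʳ i)

  ⊕-inverseʳ : ∀ i → i ⊕ ⊖ i ≡ zero
  ⊕-inverseʳ i = Fin.toℕ-injective (begin
    toℕ (i ⊕ ⊖ i)                      ≡⟨ toℕ-⊕ i (⊖ i) ⟩
    (toℕ i + toℕ (⊖ i)) % N            ≡⟨ cong (λ x → (toℕ i + x) % N) (toℕ-⊖ i) ⟩
    (toℕ i + (N ∸ toℕ i) % N) % N      ≡⟨ [m+n%d]%d≡[m+n]%d (toℕ i) (N ∸ toℕ i) N ⟩
    (toℕ i + (N ∸ toℕ i)) % N          ≡⟨ cong (_% N) (m+[n∸m]≡n (<⇒≤ (Fin.toℕ<n i))) ⟩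
    N % N                              ≡⟨ n%n≡0 N ⟩
    0                                  ∎)
    where open ≡-Reasoning

  ⊕-inverseˡ : ∀ i → ⊖ i ⊕ i ≡ zero
  ⊕-inverseˡ i = trans (⊕-comm (⊖ i) i) (⊕-inverseʳ i)

  ⊕⊖-cancel : ∀ i a → i ⊕ a ⊕ ⊖ a ≡ i
  ⊕⊖-cancel i a = trans (⊕-assoc i a (⊖ a)) (trans (cong (i ⊕_) (⊕-inverseʳ a)) (⊕-identityʳ i))

  ⊖⊕-cancel : ∀ i a → i ⊕ ⊖ a ⊕ a ≡ i
  ⊖⊕-cancel i a = trans (⊕-assoc i (⊖ a) a) (trans (cong (i ⊕_) (⊕-inverseˡ a)) (⊕-identityʳ i))

  ⊕-cancelʳ : ∀ a {i j} → i ⊕ a ≡ j ⊕ a → i ≡ j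
  ⊕-cancelʳ a {i} {j} eq = trans (sym (⊕⊖-cancel i a)) (trans (cong (_⊕ ⊖ a) eq) (⊕⊖-cancel j a))

  ⊕-cancelˡ : ∀ a {i j} → a ⊕ i ≡ a ⊕ j → i ≡ j
  ⊕-cancelˡ a {i} {j} eq = ⊕-cancelʳ a (trans (⊕-comm i a) (trans eq (⊕-comm a j)))

  i⊕a≡j⇒i≡j⊕⊖a : ∀ {i a j} → i ⊕ a ≡ j → i ≡ j ⊕ ⊖ a
  i⊕a≡j⇒i≡j⊕⊖a {i} {a} eq = trans (sym (⊕⊖-cancel i a)) (cong (_⊕ ⊖ a) eq)

  ⊕-swapʳ : ∀ i a b → i ⊕ a ⊕ b ≡ i ⊕ b ⊕ a
  ⊕-swapʳ i a b = trans (⊕-assoc i a b) (trans (cong (i ⊕_) (⊕-comm a b)) (sym (⊕-assoc i b a)))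

  rotation : Fin N → Permutation′ N
  rotation a = permutation (_⊕ a) (_⊕ ⊖ a) (λ i → ⊖⊕-cancel i a) (λ i → ⊕⊖-cancel i a)

  InRotations : (Fin N → Fin N) → Set
  InRotations f = ∃[ e ] ∀ i → f i ≡ i ⊕ e

  inRotations? : ∀ f → Dec (InRotations f)
  inRotations? f = map′ (λ f≗ → f zero , f≗) (λ { (e , f≗) i → trans (f≗ i) (cong (i ⊕_) (sym (trans (f≗ zero) (⊕-identityˡ e)))) })
    (Fin.all? (λ i → f i Fin.≟ i ⊕ f zero))

-- Double cosets of Zₙ

module DoubleCosets (k : ℕ) where
  open Rotations k

  infix 4 _∼_ _∼?_

  record _∼_ (f g : Fin N → Fin N) : Set where
    constructor mk∼
    field
      left right : Fin N
      twisted    : ∀ i → g i ≡ f (i ⊕ right) ⊕ left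

  ∼⇒InDoubleCoset : ∀ {f g} → f ∼ g → InDoubleCoset N f g
  ∼⇒InDoubleCoset {f} (mk∼ a b g≗afb) = a , b , λ i → trans (g≗afb i) (trans (⊕≡rot _ a) (cong (rot N a ∘ f) (⊕≡rot i b)))

  InDoubleCoset⇒∼ : ∀ {f g} → InDoubleCoset N f g → f ∼ g
  InDoubleCoset⇒∼ {f} (a , b , g≗afb) = mk∼ a b λ i → trans (g≗afb i) (sym (trans (⊕≡rot _ a) (cong (rot N a ∘ f) (⊕≡rot i b))))

  _∼?_ : ∀ f g → Dec (f ∼ g)
  f ∼? g = map′ (λ (a , b , g≗afb) → mk∼ a b g≗afb) (λ (mk∼ a b g≗afb) → a , b , g≗afb)
    (Fin.any? λ a → Fin.any? λ b → Fin.all? λ i → g i Fin.≟ f (i ⊕ b) ⊕ a)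

  ∼-refl : ∀ f → f ∼ f
  ∼-refl f = mk∼ zero zero λ i → sym (trans (⊕-identityʳ _) (cong f (⊕-identityʳ i)))

  ∼-sym : ∀ {f g} → f ∼ g → g ∼ f
  ∼-sym {f} {g} (mk∼ a b g≗afb) = mk∼ (⊖ a) (⊖ b) λ i → sym (begin
    g (i ⊕ ⊖ b) ⊕ ⊖ a           ≡⟨ cong (_⊕ ⊖ a) (g≗afb (i ⊕ ⊖ b)) ⟩
    f (i ⊕ ⊖ b ⊕ b) ⊕ a ⊕ ⊖ a   ≡⟨ ⊕⊖-cancel _ a ⟩
    f (i ⊕ ⊖ b ⊕ b)             ≡⟨ cong f (⊖⊕-cancel i b) ⟩
    f i                         ∎)
    where open ≡-Reasoning

  ∼-trans : ∀ {f g h} → f ∼ g → g ∼ h → f ∼ h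
  ∼-trans {f} {g} {h} (mk∼ a b g≗afb) (mk∼ a′ b′ h≗a′gb′) = mk∼ (a ⊕ a′) (b′ ⊕ b) λ i → begin
    h i                             ≡⟨ h≗a′gb′ i ⟩
    g (i ⊕ b′) ⊕ a′                 ≡⟨ cong (_⊕ a′) (g≗afb (i ⊕ b′)) ⟩
    f (i ⊕ b′ ⊕ b) ⊕ a ⊕ a′         ≡⟨ cong (λ j → f j ⊕ a ⊕ a′) (⊕-assoc i b′ b) ⟩
    f (i ⊕ (b′ ⊕ b)) ⊕ a ⊕ a′       ≡⟨ ⊕-assoc (f (i ⊕ (b′ ⊕ b))) a a′ ⟩
    f (i ⊕ (b′ ⊕ b)) ⊕ (a ⊕ a′)     ∎
    where open ≡-Reasoning

  ∼-respʳ : ∀ {f g g′} → (∀ i → g i ≡ g′ i) → f ∼ g → f ∼ g′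
  ∼-respʳ g≗g′ (mk∼ a b g≗afb) = mk∼ a b λ i → trans (sym (g≗g′ i)) (g≗afb i)

  InRotations-resp-∼ : ∀ {f g} → f ∼ g → InRotations f → InRotations g
  InRotations-resp-∼ {f} {g} (mk∼ a b g≗afb) (e , f≗e) = b ⊕ e ⊕ a , λ i → begin
    g i                ≡⟨ g≗afb i ⟩
    f (i ⊕ b) ⊕ a      ≡⟨ cong (_⊕ a) (f≗e (i ⊕ b)) ⟩
    i ⊕ b ⊕ e ⊕ a      ≡⟨ cong (_⊕ a) (⊕-assoc i b e) ⟩
    i ⊕ (b ⊕ e) ⊕ a    ≡⟨ ⊕-assoc i (b ⊕ e) a ⟩
    i ⊕ (b ⊕ e ⊕ a)    ∎
    where open ≡-Reasoning

  IsRotationRoot : (Fin N → Fin N) → Set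
  IsRotationRoot f = InRotations (λ i → f (f i))

  isRotationRoot? : ∀ f → Dec (IsRotationRoot f)
  isRotationRoot? f = inRotations? (λ i → f (f i))

  𝟙-root : Vec (Fin N) N → ℕ
  𝟙-root x = 𝟙 (isRotationRoot? (lookup x))

  ∑-shift : ∀ a (f : Fin N → ℕ) → ∑[ b ∈ allFin N ] f (b ⊕ a) ≡ ∑ (allFin N) f
  ∑-shift a f = ∑-reindex (allFin-isEnumeration N) (allFin-isEnumeration N)
    (_⊕ a) (_⊕ ⊖ a) (λ b → ⊕⊖-cancel b a) (λ b → ⊖⊕-cancel b a) f

  ∑-rotations-isSquareRoot : ∀ x → ∑[ a ∈ allFin N ] 𝟙 (isSquareRoot? (_⊕ a) x) ≡ 𝟙-root x
  ∑-rotations-isSquareRoot x = count (isRotationRoot? (lookup x))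
    where
    count : (D : Dec (IsRotationRoot (lookup x))) → ∑[ a ∈ allFin N ] 𝟙 (isSquareRoot? (_⊕ a) x) ≡ 𝟙 D
    count (yes (e , x²≗e)) = trans
      (∑-cong (allFin N) λ a → 𝟙-cong (isSquareRoot? (_⊕ a) x) (e Fin.≟ a)
        (λ x²≗a → ⊕-cancelˡ zero (trans (sym (x²≗e zero)) (x²≗a zero))) λ { refl → x²≗e })
      (count≡1 (allFin-isEnumeration N) e)
    count (no ¬x²∈Z) = trans
      (∑-cong (allFin N) λ a → 𝟙-no (isSquareRoot? (_⊕ a) x) λ x²≗a → ¬x²∈Z (a , x²≗a))
      (∑-zero (allFin N))

  twist : (Fin N → Fin N) → Fin N → Fin N → Vec (Fin N) N
  twist y a b = tabulate (λ i → y (i ⊕ b) ⊕ a)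

  lookup-twist : ∀ y a b i → lookup (twist y a b) i ≡ y (i ⊕ b) ⊕ a
  lookup-twist y a b = Vec.lookup∘tabulate (λ i → y (i ⊕ b) ⊕ a)

  twist≡⇒ : ∀ y a b {x} → twist y a b ≡ x → ∀ i → y (i ⊕ b) ⊕ a ≡ lookup x i
  twist≡⇒ y a b refl i = sym (lookup-twist y a b i)

  twist≡⇐ : ∀ y a b {x} → (∀ i → y (i ⊕ b) ⊕ a ≡ lookup x i) → twist y a b ≡ x
  twist≡⇐ y a b twist≗x = lookup-injective λ i → trans (lookup-twist y a b i) (twist≗x i)

  module ClassCount (y : Fin N → Fin N) (e : Fin N) (y²≗e : ∀ i → y (y i) ≡ i ⊕ e) where

    open ≡-Reasoning

    -- ψ c = [y rᶜ y ∈ Zₙ]; since y² ∈ Zₙ, K = ∑ ψ is the number of pairs (a, b) with rᵃ y rᵇ = y.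
    ψ : Fin N → ℕ
    ψ c = 𝟙 (inRotations? (λ j → y (y j ⊕ c)))

    K : ℕ
    K = ∑ (allFin N) ψ

    ŷ : Vec (Fin N) N
    ŷ = tabulate y

    multiplicity : Vec (Fin N) N → ℕ
    multiplicity x = ∑[ a ∈ allFin N ] ∑[ b ∈ allFin N ] 𝟙 (twist y a b ≟ᵛ x)

    y-surjective : ∀ i → y (y (i ⊕ ⊖ e)) ≡ i
    y-surjective i = trans (y²≗e (i ⊕ ⊖ e)) (⊖⊕-cancel i e)

    𝟙-root-twist : ∀ a b → 𝟙-root (twist y a b) ≡ ψ (a ⊕ b)
    𝟙-root-twist a b = 𝟙-cong (isRotationRoot? (lookup (twist y a b))) (inRotations? (λ j → y (y j ⊕ (a ⊕ b))))
      (InRotations-resp-∼ (∼-sym twist²∼)) (InRotations-resp-∼ twist²∼)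
      where
      twist²∼ : (λ j → y (y j ⊕ (a ⊕ b))) ∼ (λ i → lookup (twist y a b) (lookup (twist y a b) i))
      twist²∼ = mk∼ a b λ i → begin
        lookup (twist y a b) (lookup (twist y a b) i) ≡⟨ lookup-twist y a b _ ⟩
        y (lookup (twist y a b) i ⊕ b) ⊕ a           ≡⟨ cong (λ j → y (j ⊕ b) ⊕ a) (lookup-twist y a b i) ⟩
        y (y (i ⊕ b) ⊕ a ⊕ b) ⊕ a                    ≡⟨ cong (λ j → y j ⊕ a) (⊕-assoc (y (i ⊕ b)) a b) ⟩
        y (y (i ⊕ b) ⊕ (a ⊕ b)) ⊕ a                  ∎

    ∑-𝟙-root-twist : ∑[ a ∈ allFin N ] ∑[ b ∈ allFin N ] 𝟙-root (twist y a b) ≡ N * K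
    ∑-𝟙-root-twist = begin
      ∑[ a ∈ allFin N ] ∑[ b ∈ allFin N ] 𝟙-root (twist y a b) ≡⟨ ∑-cong (allFin N) (λ a → ∑-cong (allFin N) (𝟙-root-twist a)) ⟩
      ∑[ a ∈ allFin N ] ∑[ b ∈ allFin N ] ψ (a ⊕ b)       ≡⟨ ∑-cong (allFin N) (λ a → trans (∑-cong (allFin N) (λ b → cong ψ (⊕-comm a b))) (∑-shift a ψ)) ⟩
      ∑[ a ∈ allFin N ] K                               ≡⟨ ∑-allFin-const N K ⟩
      N * K                                             ∎

    lookup-ŷ : ∀ i → lookup ŷ i ≡ y i
    lookup-ŷ = Vec.lookup∘tabulate y

    twist≡ŷ⇒ : ∀ {a b t} → (∀ j → y (y j ⊕ b) ≡ j ⊕ t) → twist y a b ≡ ŷ → e ⊕ ⊖ t ≡ a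
    twist≡ŷ⇒ {a} {b} {t} yrᵇy≗t twist≡ŷ = sym (i⊕a≡j⇒i≡j⊕⊖a (trans (⊕-comm a t) (⊕-cancelˡ zero (begin
      zero ⊕ (t ⊕ a)          ≡⟨ ⊕-assoc zero t a ⟨
      zero ⊕ t ⊕ a            ≡⟨ cong (_⊕ a) (yrᵇy≗t zero) ⟨
      y (y zero ⊕ b) ⊕ a      ≡⟨ twist≡⇒ y a b twist≡ŷ (y zero) ⟩
      lookup ŷ (y zero)       ≡⟨ lookup-ŷ (y zero) ⟩
      y (y zero)              ≡⟨ y²≗e zero ⟩
      zero ⊕ e                ∎))))

    twist≡ŷ⇐ : ∀ {b t} → (∀ j → y (y j ⊕ b) ≡ j ⊕ t) → twist y (e ⊕ ⊖ t) b ≡ ŷ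
    twist≡ŷ⇐ {b} {t} yrᵇy≗t = twist≡⇐ y (e ⊕ ⊖ t) b λ i → let j = y (i ⊕ ⊖ e) in begin
      y (i ⊕ b) ⊕ (e ⊕ ⊖ t)         ≡⟨ cong (λ i′ → y (i′ ⊕ b) ⊕ (e ⊕ ⊖ t)) (y-surjective i) ⟨
      y (y j ⊕ b) ⊕ (e ⊕ ⊖ t)       ≡⟨ cong (_⊕ (e ⊕ ⊖ t)) (yrᵇy≗t j) ⟩
      j ⊕ t ⊕ (e ⊕ ⊖ t)             ≡⟨ ⊕-assoc j t (e ⊕ ⊖ t) ⟩
      j ⊕ (t ⊕ (e ⊕ ⊖ t))           ≡⟨ cong (j ⊕_) (trans (⊕-comm t (e ⊕ ⊖ t)) (⊖⊕-cancel e t)) ⟩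
      j ⊕ e                         ≡⟨ y²≗e j ⟨
      y (y j)                       ≡⟨ cong y (y-surjective i) ⟩
      y i                           ≡⟨ lookup-ŷ i ⟨
      lookup ŷ i                    ∎

    twist≡ŷ⇒yrᵇy∈Z : ∀ {a b} → twist y a b ≡ ŷ → InRotations (λ j → y (y j ⊕ b))
    twist≡ŷ⇒yrᵇy∈Z {a} {b} twist≡ŷ = e ⊕ ⊖ a , λ j → begin
      y (y j ⊕ b)             ≡⟨ i⊕a≡j⇒i≡j⊕⊖a (trans (twist≡⇒ y a b twist≡ŷ (y j)) (lookup-ŷ (y j))) ⟩
      y (y j) ⊕ ⊖ a           ≡⟨ cong (_⊕ ⊖ a) (y²≗e j) ⟩
      j ⊕ e ⊕ ⊖ a             ≡⟨ ⊕-assoc j e (⊖ a) ⟩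
      j ⊕ (e ⊕ ⊖ a)           ∎

    ∑-twist≡ŷ : ∀ b → ∑[ a ∈ allFin N ] 𝟙 (twist y a b ≟ᵛ ŷ) ≡ ψ b
    ∑-twist≡ŷ b = count (inRotations? (λ j → y (y j ⊕ b)))
      where
      count : (D : Dec (InRotations (λ j → y (y j ⊕ b)))) → ∑[ a ∈ allFin N ] 𝟙 (twist y a b ≟ᵛ ŷ) ≡ 𝟙 D
      count (yes (t , yrᵇy≗t)) = trans
        (∑-cong (allFin N) λ a → 𝟙-cong (twist y a b ≟ᵛ ŷ) (e ⊕ ⊖ t Fin.≟ a) (twist≡ŷ⇒ yrᵇy≗t) λ { refl → twist≡ŷ⇐ yrᵇy≗t })
        (count≡1 (allFin-isEnumeration N) (e ⊕ ⊖ t))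
      count (no yrᵇy∉Z) = trans
        (∑-cong (allFin N) λ a → 𝟙-no (twist y a b ≟ᵛ ŷ) (yrᵇy∉Z ∘ twist≡ŷ⇒yrᵇy∈Z))
        (∑-zero (allFin N))

    multiplicity-ŷ : multiplicity ŷ ≡ K
    multiplicity-ŷ = trans (∑-comm (allFin N) (allFin N) _) (∑-cong (allFin N) ∑-twist≡ŷ)

    module _ {x a₀ b₀} (x≗a₀yb₀ : ∀ i → lookup x i ≡ y (i ⊕ b₀) ⊕ a₀) where

      twist≡x⇒ : ∀ {a b} → twist y a b ≡ x → twist y (a ⊕ ⊖ a₀) (b ⊕ ⊖ b₀) ≡ ŷ
      twist≡x⇒ {a} {b} twist≡x = twist≡⇐ y (a ⊕ ⊖ a₀) (b ⊕ ⊖ b₀) λ i → begin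
        y (i ⊕ (b ⊕ ⊖ b₀)) ⊕ (a ⊕ ⊖ a₀)     ≡⟨ cong (λ j → y j ⊕ (a ⊕ ⊖ a₀)) (trans (sym (⊕-assoc i b (⊖ b₀))) (⊕-swapʳ i b (⊖ b₀))) ⟩
        y (i ⊕ ⊖ b₀ ⊕ b) ⊕ (a ⊕ ⊖ a₀)       ≡⟨ ⊕-assoc (y (i ⊕ ⊖ b₀ ⊕ b)) a (⊖ a₀) ⟨
        y (i ⊕ ⊖ b₀ ⊕ b) ⊕ a ⊕ ⊖ a₀         ≡⟨ cong (_⊕ ⊖ a₀) (trans (twist≡⇒ y a b twist≡x (i ⊕ ⊖ b₀)) (x≗a₀yb₀ (i ⊕ ⊖ b₀))) ⟩
        y (i ⊕ ⊖ b₀ ⊕ b₀) ⊕ a₀ ⊕ ⊖ a₀       ≡⟨ ⊕⊖-cancel (y (i ⊕ ⊖ b₀ ⊕ b₀)) a₀ ⟩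
        y (i ⊕ ⊖ b₀ ⊕ b₀)                   ≡⟨ cong y (⊖⊕-cancel i b₀) ⟩
        y i                                 ≡⟨ lookup-ŷ i ⟨
        lookup ŷ i                          ∎

      twist≡x⇐ : ∀ {a b} → twist y (a ⊕ ⊖ a₀) (b ⊕ ⊖ b₀) ≡ ŷ → twist y a b ≡ x
      twist≡x⇐ {a} {b} twist≡ŷ = twist≡⇐ y a b λ i → begin
        y (i ⊕ b) ⊕ a                             ≡⟨ cong (y (i ⊕ b) ⊕_) (⊖⊕-cancel a a₀) ⟨
        y (i ⊕ b) ⊕ (a ⊕ ⊖ a₀ ⊕ a₀)               ≡⟨ ⊕-assoc (y (i ⊕ b)) (a ⊕ ⊖ a₀) a₀ ⟨
        y (i ⊕ b) ⊕ (a ⊕ ⊖ a₀) ⊕ a₀               ≡⟨ cong (λ j → y j ⊕ (a ⊕ ⊖ a₀) ⊕ a₀) (shift i) ⟨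
        y (i ⊕ b₀ ⊕ (b ⊕ ⊖ b₀)) ⊕ (a ⊕ ⊖ a₀) ⊕ a₀ ≡⟨ cong (_⊕ a₀) (twist≡⇒ y (a ⊕ ⊖ a₀) (b ⊕ ⊖ b₀) twist≡ŷ (i ⊕ b₀)) ⟩
        lookup ŷ (i ⊕ b₀) ⊕ a₀                    ≡⟨ cong (_⊕ a₀) (lookup-ŷ (i ⊕ b₀)) ⟩
        y (i ⊕ b₀) ⊕ a₀                           ≡⟨ x≗a₀yb₀ i ⟨
        lookup x i                                ∎
        where
        shift : ∀ i → i ⊕ b₀ ⊕ (b ⊕ ⊖ b₀) ≡ i ⊕ b
        shift i = trans (sym (⊕-assoc (i ⊕ b₀) b (⊖ b₀))) (trans (cong (_⊕ ⊖ b₀) (⊕-swapʳ i b₀ b)) (⊕⊖-cancel (i ⊕ b) b₀))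

    multiplicity-class : ∀ x → multiplicity x ≡ K * 𝟙 (y ∼? lookup x)
    multiplicity-class x = count (y ∼? lookup x)
      where
      count : (D : Dec (y ∼ lookup x)) → multiplicity x ≡ K * 𝟙 D
      count (yes (mk∼ a₀ b₀ x≗a₀yb₀)) = begin
        multiplicity x                                                              ≡⟨ ∑-cong (allFin N) (λ a → ∑-cong (allFin N) λ b →
                                                                                         𝟙-cong (twist y a b ≟ᵛ x) (twist y (a ⊕ ⊖ a₀) (b ⊕ ⊖ b₀) ≟ᵛ ŷ)
                                                                                           (twist≡x⇒ x≗a₀yb₀) (twist≡x⇐ x≗a₀yb₀)) ⟩
        ∑[ a ∈ allFin N ] ∑[ b ∈ allFin N ] 𝟙 (twist y (a ⊕ ⊖ a₀) (b ⊕ ⊖ b₀) ≟ᵛ ŷ) ≡⟨ ∑-cong (allFin N) (λ a → ∑-shift (⊖ b₀) (λ b → 𝟙 (twist y (a ⊕ ⊖ a₀) b ≟ᵛ ŷ))) ⟩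
        ∑[ a ∈ allFin N ] ∑[ b ∈ allFin N ] 𝟙 (twist y (a ⊕ ⊖ a₀) b ≟ᵛ ŷ)          ≡⟨ ∑-shift (⊖ a₀) (λ a → ∑[ b ∈ allFin N ] 𝟙 (twist y a b ≟ᵛ ŷ)) ⟩
        multiplicity ŷ                                                              ≡⟨ multiplicity-ŷ ⟩
        K                                                                           ≡⟨ *-identityʳ K ⟨
        K * 1                                                                       ∎
      count (no y≁x) = begin
        multiplicity x                              ≡⟨ ∑-cong (allFin N) (λ a → ∑-cong (allFin N) λ b →
                                                         𝟙-no (twist y a b ≟ᵛ x) λ twist≡x → y≁x (mk∼ a b λ i → sym (twist≡⇒ y a b twist≡x i))) ⟩
        ∑[ a ∈ allFin N ] ∑[ b ∈ allFin N ] 0       ≡⟨ ∑-cong (allFin N) (λ a → ∑-zero (allFin N)) ⟩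
        ∑[ a ∈ allFin N ] 0                         ≡⟨ ∑-zero (allFin N) ⟩
        0                                           ≡⟨ *-zeroʳ K ⟨
        K * 0                                       ∎

    ∑-𝟙-root-twist≡∑-multiplicity : ∑[ a ∈ allFin N ] ∑[ b ∈ allFin N ] 𝟙-root (twist y a b) ≡ ∑[ x ∈ allVecs N ] multiplicity x * 𝟙-root x
    ∑-𝟙-root-twist≡∑-multiplicity = begin
      ∑[ a ∈ allFin N ] ∑[ b ∈ allFin N ] 𝟙-root (twist y a b)
        ≡⟨ ∑-cong (allFin N) (λ a → ∑-cong (allFin N) λ b → ∑-δ _≟ᵛ_ (allVecs N) (twist y a b) (count≡1 (allVecs-isEnumeration N) (twist y a b)) 𝟙-root) ⟨
      ∑[ a ∈ allFin N ] ∑[ b ∈ allFin N ] ∑[ x ∈ allVecs N ] 𝟙 (twist y a b ≟ᵛ x) * 𝟙-root x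
        ≡⟨ ∑-cong (allFin N) (λ a → ∑-comm (allFin N) (allVecs N) _) ⟩
      ∑[ a ∈ allFin N ] ∑[ x ∈ allVecs N ] ∑[ b ∈ allFin N ] 𝟙 (twist y a b ≟ᵛ x) * 𝟙-root x
        ≡⟨ ∑-comm (allFin N) (allVecs N) _ ⟩
      ∑[ x ∈ allVecs N ] ∑[ a ∈ allFin N ] ∑[ b ∈ allFin N ] 𝟙 (twist y a b ≟ᵛ x) * 𝟙-root x
        ≡⟨ ∑-cong (allVecs N) (λ x → trans (*-distribʳ-∑ (𝟙-root x) (allFin N) (λ a → ∑[ b ∈ allFin N ] 𝟙 (twist y a b ≟ᵛ x)))
                                             (∑-cong (allFin N) λ a → *-distribʳ-∑ (𝟙-root x) (allFin N) (λ b → 𝟙 (twist y a b ≟ᵛ x)))) ⟨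
      ∑[ x ∈ allVecs N ] multiplicity x * 𝟙-root x
        ∎

    K≢0 : NonZero K
    K≢0 = >-nonZero (≤-trans (≤-reflexive (sym ψ-zero)) (m≤m+n (ψ zero) _))
      where
      ψ-zero : ψ zero ≡ 1
      ψ-zero = 𝟙-yes (inRotations? (λ j → y (y j ⊕ zero))) (e , λ j → trans (cong y (⊕-identityʳ (y j))) (y²≗e j))

    class-count : ∑[ x ∈ allVecs N ] 𝟙-root x * 𝟙 (y ∼? lookup x) ≡ N
    class-count = *-cancelˡ-≡ _ N K {{K≢0}} (begin
      K * (∑[ x ∈ allVecs N ] 𝟙-root x * 𝟙 (y ∼? lookup x))   ≡⟨ *-distribˡ-∑ K (allVecs N) _ ⟩
      ∑[ x ∈ allVecs N ] K * (𝟙-root x * 𝟙 (y ∼? lookup x))   ≡⟨ ∑-cong (allVecs N) (λ x → reorder K (𝟙-root x) _) ⟩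
      ∑[ x ∈ allVecs N ] K * 𝟙 (y ∼? lookup x) * 𝟙-root x     ≡⟨ ∑-cong (allVecs N) (λ x → cong (_* 𝟙-root x) (multiplicity-class x)) ⟨
      ∑[ x ∈ allVecs N ] multiplicity x * 𝟙-root x            ≡⟨ ∑-𝟙-root-twist≡∑-multiplicity ⟨
      ∑[ a ∈ allFin N ] ∑[ b ∈ allFin N ] 𝟙-root (twist y a b) ≡⟨ ∑-𝟙-root-twist ⟩
      N * K                                              ≡⟨ *-comm N K ⟩
      K * N                                              ∎)
      where
      reorder : ∀ a b c → a * (b * c) ≡ a * c * b
      reorder a b c = trans (cong (a *_) (*-comm b c)) (sym (*-assoc a c b))

-- A system of representatives of Θ

InClassOf⇒Any : ∀ {n} .{{_ : NonZero n}} {g : Permutation′ n} {rs} →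
                g InClassOf rs → Any (λ r → InDoubleCoset n (r ⟨$⟩ʳ_) (g ⟨$⟩ʳ_)) rs
InClassOf⇒Any {rs = r ∷ rs} (inj₁ g∈rgr) = here g∈rgr
InClassOf⇒Any {rs = r ∷ rs} (inj₂ g∈rs)  = there (InClassOf⇒Any g∈rs)

Any⇒InClassOf : ∀ {n} .{{_ : NonZero n}} {g : Permutation′ n} {rs} →
                Any (λ r → InDoubleCoset n (r ⟨$⟩ʳ_) (g ⟨$⟩ʳ_)) rs → g InClassOf rs
Any⇒InClassOf (here g∈rgr) = inj₁ g∈rgr
Any⇒InClassOf (there g∈rs) = inj₂ (Any⇒InClassOf g∈rs)

AllPairs⇒PairwiseDistinctCosets : ∀ {n} .{{_ : NonZero n}} {rs : List (Permutation′ n)} →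
  AllPairs (λ r s → ¬ InDoubleCoset n (s ⟨$⟩ʳ_) (r ⟨$⟩ʳ_)) rs → PairwiseDistinctCosets rs
AllPairs⇒PairwiseDistinctCosets []           = tt
AllPairs⇒PairwiseDistinctCosets (r≁rs ∷ pw) = All.All¬⇒¬Any r≁rs ∘ InClassOf⇒Any , AllPairs⇒PairwiseDistinctCosets pw

module RepresentativeSystem (k : ℕ) where
  open Rotations k
  open DoubleCosets k

  _≈_ : Permutation′ N → Permutation′ N → Set
  g ≈ h = (g ⟨$⟩ʳ_) ∼ (h ⟨$⟩ʳ_)

  _≈?_ : ∀ g h → Dec (g ≈ h)
  g ≈? h = (g ⟨$⟩ʳ_) ∼? (h ⟨$⟩ʳ_)

  root-commutes : ∀ f {e} → (∀ i → f (f i) ≡ i ⊕ e) → ∀ i → f (i ⊕ ⊖ e) ≡ f i ⊕ ⊖ e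
  root-commutes f {e} f²≗e i = i⊕a≡j⇒i≡j⊕⊖a (begin
    f (i ⊕ ⊖ e) ⊕ e          ≡⟨ f²≗e (f (i ⊕ ⊖ e)) ⟨
    f (f (f (i ⊕ ⊖ e)))      ≡⟨ cong f (f²≗e (i ⊕ ⊖ e)) ⟩
    f (i ⊕ ⊖ e ⊕ e)          ≡⟨ cong f (⊖⊕-cancel i e) ⟩
    f i                      ∎)
    where open ≡-Reasoning

  fromRoot : ∀ f → IsRotationRoot f → Permutation′ N
  fromRoot f (e , f²≗e) = permutation f (λ i → f (i ⊕ ⊖ e))
    (λ i → trans (f²≗e (i ⊕ ⊖ e)) (⊖⊕-cancel i e))
    (λ i → trans (root-commutes f f²≗e (f i)) (trans (cong (_⊕ ⊖ e) (f²≗e i)) (⊕⊖-cancel i e)))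

  -- Vectors that are not roots of a rotation are sent to a junk value; only roots are ever converted.
  rootPermutation : ∀ f → Dec (IsRotationRoot f) → Permutation′ N
  rootPermutation f (yes f²∈Z) = fromRoot f f²∈Z
  rootPermutation f (no _)     = Perm.id

  rootPermutation-⟨$⟩ʳ : ∀ f (D : Dec (IsRotationRoot f)) → IsRotationRoot f → ∀ i → rootPermutation f D ⟨$⟩ʳ i ≡ f i
  rootPermutation-⟨$⟩ʳ f (yes _)    _    i = refl
  rootPermutation-⟨$⟩ʳ f (no ¬f²∈Z) f²∈Z i = contradiction f²∈Z ¬f²∈Z

  toPermutation : Vec (Fin N) N → Permutation′ N
  toPermutation x = rootPermutation (lookup x) (isRotationRoot? (lookup x))

  toPermutation-⟨$⟩ʳ : ∀ x → IsRotationRoot (lookup x) → ∀ i → toPermutation x ⟨$⟩ʳ i ≡ lookup x i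
  toPermutation-⟨$⟩ʳ x = rootPermutation-⟨$⟩ʳ (lookup x) (isRotationRoot? (lookup x))

  IsRotationRoot-resp-≗ : ∀ f g → (∀ i → f i ≡ g i) → IsRotationRoot f → IsRotationRoot g
  IsRotationRoot-resp-≗ f g f≗g (e , f²≗e) = e , λ i → trans (sym (f≗g (g i))) (trans (cong f (sym (f≗g i))) (f²≗e i))

  roots : List (Vec (Fin N) N)
  roots = filter (isRotationRoot? ∘ lookup) (allVecs N)

  representatives : List (Permutation′ N)
  representatives = deduplicate _≈?_ (map toPermutation roots)

  representatives-roots : All (λ r → IsRotationRoot (r ⟨$⟩ʳ_)) representatives
  representatives-roots = All.deduplicate⁺ _≈?_ (All.map⁺ (All.map (λ {x} x²∈Z → IsRotationRoot-resp-≗ (lookup x) (toPermutation x ⟨$⟩ʳ_) (sym ∘ toPermutation-⟨$⟩ʳ x x²∈Z) x²∈Z)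
    (All.all-filter (isRotationRoot? ∘ lookup) (allVecs N))))

  ≈-trans : ∀ {f g h} → f ≈ g → g ≈ h → f ≈ h
  ≈-trans {f} {g} {h} = ∼-trans {f ⟨$⟩ʳ_} {g ⟨$⟩ʳ_} {h ⟨$⟩ʳ_}

  representatives-cover : ∀ x → IsRotationRoot (lookup x) → Any (λ r → (r ⟨$⟩ʳ_) ∼ lookup x) representatives
  representatives-cover x x²∈Z = Any.map (∼-respʳ (toPermutation-⟨$⟩ʳ x x²∈Z))
    (deduplicate-covers _≈?_ (λ {f} {g} {h} → ≈-trans {f} {g} {h}) {toPermutation x} (Any.map (λ { refl → ∼-refl (toPermutation x ⟨$⟩ʳ_) }) toPermutation-x∈))
    where
    toPermutation-x∈ : toPermutation x ∈ map toPermutation roots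
    toPermutation-x∈ = ∈-map⁺ toPermutation (∈-filter⁺ (isRotationRoot? ∘ lookup) (∈-counted-once _≟ᵛ_ (allVecs N) x (count≡1 (allVecs-isEnumeration N) x)) x²∈Z)

  representatives-pairwise : AllPairs (λ r s → ¬ r ≈ s) representatives
  representatives-pairwise = deduplicate-pairwise _≈?_ (map toPermutation roots)

  representatives-complete : ∀ g → SelfInverse N g → g InClassOf representatives
  representatives-complete g g⁻¹∈ZgZ with InDoubleCoset⇒∼ {g ⟨$⟩ʳ_} g⁻¹∈ZgZ
  ... | mk∼ a b g⁻¹≗agb = Any⇒InClassOf (Any.map (λ r∼y → ∼⇒InDoubleCoset (∼-trans r∼y y∼g)) (representatives-cover y y²∈Z))
    where
    y : Vec (Fin N) N
    y = tabulate (λ i → g ⟨$⟩ʳ (i ⊕ b))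
    y≗gb : ∀ i → lookup y i ≡ g ⟨$⟩ʳ (i ⊕ b)
    y≗gb = Vec.lookup∘tabulate (λ i → g ⟨$⟩ʳ (i ⊕ b))
    y²∈Z : IsRotationRoot (lookup y)
    y²∈Z = b ⊕ ⊖ a , λ i → begin
      lookup y (lookup y i)          ≡⟨ trans (y≗gb _) (cong (λ j → g ⟨$⟩ʳ (j ⊕ b)) (y≗gb i)) ⟩
      g ⟨$⟩ʳ ((g ⟨$⟩ʳ (i ⊕ b)) ⊕ b)   ≡⟨ i⊕a≡j⇒i≡j⊕⊖a (sym (g⁻¹≗agb _)) ⟩
      (g ⟨$⟩ˡ (g ⟨$⟩ʳ (i ⊕ b))) ⊕ ⊖ a ≡⟨ cong (_⊕ ⊖ a) (inverseˡ g) ⟩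
      i ⊕ b ⊕ ⊖ a                    ≡⟨ ⊕-assoc i b (⊖ a) ⟩
      i ⊕ (b ⊕ ⊖ a)                  ∎
      where open ≡-Reasoning
    y∼g : lookup y ∼ (g ⟨$⟩ʳ_)
    y∼g = mk∼ zero (⊖ b) λ i → sym (trans (⊕-identityʳ _) (trans (y≗gb _) (cong (g ⟨$⟩ʳ_) (⊖⊕-cancel i b))))

  ∑-𝟙-representative-classes : ∀ x → IsRotationRoot (lookup x) → ∑[ r ∈ representatives ] 𝟙 ((r ⟨$⟩ʳ_) ∼? lookup x) ≡ 1
  ∑-𝟙-representative-classes x x²∈Z = trans (sym (∑-map _⟨$⟩ʳ_ representatives (λ f → 𝟙 (f ∼? lookup x))))
    (∑-𝟙-representatives _∼?_ ∼-sym ∼-trans (AllPairs.map⁺ representatives-pairwise) (Any.map⁺ (representatives-cover x x²∈Z)))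

  ∑-𝟙-root : ∑[ x ∈ allVecs N ] 𝟙-root x ≡ length representatives * N
  ∑-𝟙-root = begin
    ∑[ x ∈ allVecs N ] 𝟙-root x                                                    ≡⟨ ∑-cong (allVecs N) (λ x → split x (isRotationRoot? (lookup x))) ⟩
    ∑[ x ∈ allVecs N ] 𝟙-root x * (∑[ r ∈ representatives ] 𝟙 ((r ⟨$⟩ʳ_) ∼? lookup x)) ≡⟨ ∑-cong (allVecs N) (λ x → *-distribˡ-∑ (𝟙-root x) representatives _) ⟩
    ∑[ x ∈ allVecs N ] ∑[ r ∈ representatives ] 𝟙-root x * 𝟙 ((r ⟨$⟩ʳ_) ∼? lookup x) ≡⟨ ∑-comm (allVecs N) representatives _ ⟩
    ∑[ r ∈ representatives ] ∑[ x ∈ allVecs N ] 𝟙-root x * 𝟙 ((r ⟨$⟩ʳ_) ∼? lookup x) ≡⟨ ∑-cong-All (All.map (λ {r} → class-count {r}) representatives-roots) ⟩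
    ∑[ r ∈ representatives ] N                                                ≡⟨ ∑-const representatives N ⟩
    length representatives * N                                                ∎
    where
    open ≡-Reasoning
    split : ∀ x (D : Dec (IsRotationRoot (lookup x))) → 𝟙 D ≡ 𝟙 D * (∑[ r ∈ representatives ] 𝟙 ((r ⟨$⟩ʳ_) ∼? lookup x))
    split x (yes x²∈Z) = cong (1 *_) (sym (∑-𝟙-representative-classes x x²∈Z))
    split x (no _)     = refl
    class-count : ∀ {r} → IsRotationRoot (r ⟨$⟩ʳ_) → ∑[ x ∈ allVecs N ] 𝟙-root x * 𝟙 ((r ⟨$⟩ʳ_) ∼? lookup x) ≡ N
    class-count {r} (e , r²≗e) = ClassCount.class-count (r ⟨$⟩ʳ_) e r²≗e

  root-selfInverse : ∀ g → IsRotationRoot (g ⟨$⟩ʳ_) → SelfInverse N g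
  root-selfInverse g (e , g²≗e) = ∼⇒InDoubleCoset {g ⟨$⟩ʳ_} (mk∼ zero (⊖ e) λ i → begin
    g ⟨$⟩ˡ i                                 ≡⟨ cong (g ⟨$⟩ˡ_) (trans (sym (⊖⊕-cancel i e)) (sym (g²≗e (i ⊕ ⊖ e)))) ⟩
    g ⟨$⟩ˡ (g ⟨$⟩ʳ (g ⟨$⟩ʳ (i ⊕ ⊖ e)))       ≡⟨ inverseˡ g ⟩
    g ⟨$⟩ʳ (i ⊕ ⊖ e)                         ≡⟨ ⊕-identityʳ _ ⟨
    (g ⟨$⟩ʳ (i ⊕ ⊖ e)) ⊕ zero                ∎)
    where open ≡-Reasoning

  representatives-isRepSystem : IsRepSystemΘ N representatives
  representatives-isRepSystem =
    All.map (λ {r} → root-selfInverse r) representatives-roots ,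
    AllPairs⇒PairwiseDistinctCosets (AllPairs.map (λ r≉s s∼r → r≉s (∼-sym (InDoubleCoset⇒∼ s∼r))) representatives-pairwise) ,
    representatives-complete

  N*|representatives|≡∑Sq : N * length representatives ≡ ∑[ a ∈ allFin N ] Sq (rotation a)
  N*|representatives|≡∑Sq = begin
    N * length representatives                                          ≡⟨ *-comm N _ ⟩
    length representatives * N                                          ≡⟨ ∑-𝟙-root ⟨
    ∑[ x ∈ allVecs N ] 𝟙-root x                                              ≡⟨ ∑-cong (allVecs N) ∑-rotations-isSquareRoot ⟨
    ∑[ x ∈ allVecs N ] ∑[ a ∈ allFin N ] 𝟙 (isSquareRoot? (_⊕ a) x)     ≡⟨ ∑-comm (allVecs N) (allFin N) _ ⟩
    ∑[ a ∈ allFin N ] ∑[ x ∈ allVecs N ] 𝟙 (isSquareRoot? (_⊕ a) x)     ≡⟨ ∑-cong (allFin N) (λ a → Sq≡∑-isSquareRoot (rotation a)) ⟨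
    ∑[ a ∈ allFin N ] Sq (rotation a)                                   ∎
    where open ≡-Reasoning

-- Permutations of cycle type [d^{n/d}] are conjugate to a rotation

iter-+ : ∀ {n} (f : Fin n → Fin n) a b i → iter (a + b) f i ≡ iter a f (iter b f i)
iter-+ f zero    b i = refl
iter-+ f (suc a) b i = cong f (iter-+ f a b i)

Unique⇒lookup-injective : ∀ {a} {A : Set a} {xs : List A} → Unique xs → ∀ {i j} → List.lookup xs i ≡ List.lookup xs j → i ≡ j
Unique⇒lookup-injective {xs = x ∷ xs} (x∉xs ∷ u) {zero}  {zero}  _  = refl
Unique⇒lookup-injective {xs = x ∷ xs} (x∉xs ∷ u) {zero}  {suc j} eq = contradiction eq (All.lookup x∉xs (∈-lookup j))
Unique⇒lookup-injective {xs = x ∷ xs} (x∉xs ∷ u) {suc i} {zero}  eq = contradiction (sym eq) (All.lookup x∉xs (∈-lookup i))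
Unique⇒lookup-injective {xs = x ∷ xs} (x∉xs ∷ u) {suc i} {suc j} eq = cong suc (Unique⇒lookup-injective u eq)

module CycleType (k : ℕ) (f : Fin (suc k) → Fin (suc k)) (d′ : ℕ)
  (cycles : ∀ i → iter (suc d′) f i ≡ i × (∀ j → 0 < j → j < suc d′ → ¬ iter j f i ≡ i)) where

  open Rotations k

  d : ℕ
  d = suc d′

  iter-d : ∀ i → iter d f i ≡ i
  iter-d i = proj₁ (cycles i)

  iter-*d : ∀ q i → iter (q * d) f i ≡ i
  iter-*d zero    i = refl
  iter-*d (suc q) i = trans (iter-+ f d (q * d) i) (trans (cong (iter d f) (iter-*d q i)) (iter-d i))

  iter-%d : ∀ j i → iter j f i ≡ iter (j % d) f i
  iter-%d j i = begin
    iter j f i                         ≡⟨ cong (λ j → iter j f i) (m≡m%n+[m/n]*n j d) ⟩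
    iter (j % d + j / d * d) f i       ≡⟨ iter-+ f (j % d) (j / d * d) i ⟩
    iter (j % d) f (iter (j / d * d) f i) ≡⟨ cong (iter (j % d) f) (iter-*d (j / d) i) ⟩
    iter (j % d) f i                   ∎
    where open ≡-Reasoning

  iter-back : ∀ (j : Fin d) i → iter (d ∸ toℕ j) f (iter (toℕ j) f i) ≡ i
  iter-back j i = trans (sym (iter-+ f (d ∸ toℕ j) (toℕ j) i))
    (trans (cong (λ m → iter m f i) (m∸n+n≡m (<⇒≤ (Fin.toℕ<n j)))) (iter-d i))

  iter-≢ : ∀ i (j j′ : Fin d) → toℕ j < toℕ j′ → iter (toℕ j) f i ≢ iter (toℕ j′) f i
  iter-≢ i j j′ j<j′ eq = proj₂ (cycles (iter (toℕ j) f i)) (toℕ j′ ∸ toℕ j) (m<n⇒0<n∸m j<j′)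
    (≤-<-trans (m∸n≤m (toℕ j′) (toℕ j)) (Fin.toℕ<n j′)) (begin
      iter (toℕ j′ ∸ toℕ j) f (iter (toℕ j) f i) ≡⟨ iter-+ f (toℕ j′ ∸ toℕ j) (toℕ j) i ⟨
      iter (toℕ j′ ∸ toℕ j + toℕ j) f i          ≡⟨ cong (λ m → iter m f i) (m∸n+n≡m (<⇒≤ j<j′)) ⟩
      iter (toℕ j′) f i                          ≡⟨ eq ⟨
      iter (toℕ j) f i                           ∎)
    where open ≡-Reasoning

  iter-injective : ∀ i (j j′ : Fin d) → iter (toℕ j) f i ≡ iter (toℕ j′) f i → j ≡ j′
  iter-injective i j j′ eq with <-cmp (toℕ j) (toℕ j′)
  ... | tri< j<j′ _ _ = contradiction eq (iter-≢ i j j′ j<j′)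
  ... | tri≈ _ j≡j′ _ = Fin.toℕ-injective j≡j′
  ... | tri> _ _ j′<j = contradiction (sym eq) (iter-≢ i j′ j j′<j)

  toℕ-mod-d : ∀ j → toℕ (j mod d) ≡ j % d
  toℕ-mod-d j = Fin.toℕ-fromℕ< (m%n<n j d)

  IsLeader : Fin N → Set
  IsLeader ℓ = ∀ (j : Fin d) → ℓ Fin.≤ iter (toℕ j) f ℓ

  isLeader? : ∀ ℓ → Dec (IsLeader ℓ)
  isLeader? ℓ = Fin.all? λ j → ℓ Fin.≤? iter (toℕ j) f ℓ

  leader-≤ : ∀ {ℓ} → IsLeader ℓ → ∀ j → ℓ Fin.≤ iter j f ℓ
  leader-≤ {ℓ} ℓ-leader j = subst (ℓ Fin.≤_) (trans (cong (λ m → iter m f ℓ) (toℕ-mod-d j)) (sym (iter-%d j ℓ))) (ℓ-leader (j mod d))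

  leader-≤-orbit : ∀ {ℓ ℓ′} (j j′ : Fin d) → IsLeader ℓ → iter (toℕ j) f ℓ ≡ iter (toℕ j′) f ℓ′ → ℓ Fin.≤ ℓ′
  leader-≤-orbit {ℓ} {ℓ′} j j′ ℓ-leader eq = subst (ℓ Fin.≤_) (begin
    iter (d ∸ toℕ j′ + toℕ j) f ℓ               ≡⟨ iter-+ f (d ∸ toℕ j′) (toℕ j) ℓ ⟩
    iter (d ∸ toℕ j′) f (iter (toℕ j) f ℓ)      ≡⟨ cong (iter (d ∸ toℕ j′) f) eq ⟩
    iter (d ∸ toℕ j′) f (iter (toℕ j′) f ℓ′)    ≡⟨ iter-back j′ ℓ′ ⟩
    ℓ′                                          ∎) (leader-≤ ℓ-leader (d ∸ toℕ j′ + toℕ j))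
    where open ≡-Reasoning

  decomposition-unique : ∀ {ℓ ℓ′} (j j′ : Fin d) → IsLeader ℓ → IsLeader ℓ′ →
                         iter (toℕ j) f ℓ ≡ iter (toℕ j′) f ℓ′ → ℓ ≡ ℓ′ × j ≡ j′
  decomposition-unique {ℓ} j j′ ℓ-leader ℓ′-leader eq with Fin.≤-antisym (leader-≤-orbit j j′ ℓ-leader eq) (leader-≤-orbit j′ j ℓ′-leader (sym eq))
  ... | refl = refl , iter-injective ℓ j j′ eq

  record Decomposition (i : Fin N) : Set where
    field
      leader   : Fin N
      position : Fin d
      isLeader : IsLeader leader
      reaches  : iter (toℕ position) f leader ≡ i

  opaque
    decompose : ∀ i → Decomposition i
    decompose i = record { leader = ℓ ; position = (d ∸ toℕ k₀) mod d ; isLeader = ℓ-leader ; reaches = reaches }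
      where
      open ≡-Reasoning
      h : Fin d → ℕ
      h j = toℕ (iter (toℕ j) f i)
      k₀ : Fin d
      k₀ = argmin h zero (allFin d)
      ℓ : Fin N
      ℓ = iter (toℕ k₀) f i
      ℓ-leader : IsLeader ℓ
      ℓ-leader j = subst (ℓ Fin.≤_) (begin
        iter (toℕ ((toℕ j + toℕ k₀) mod d)) f i     ≡⟨ cong (λ m → iter m f i) (toℕ-mod-d (toℕ j + toℕ k₀)) ⟩
        iter ((toℕ j + toℕ k₀) % d) f i             ≡⟨ iter-%d (toℕ j + toℕ k₀) i ⟨
        iter (toℕ j + toℕ k₀) f i                   ≡⟨ iter-+ f (toℕ j) (toℕ k₀) i ⟩
        iter (toℕ j) f ℓ                            ∎)
        (All.lookup (f[argmin]≤f[xs] {f = h} zero (allFin d)) (∈-allFin ((toℕ j + toℕ k₀) mod d)))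
      reaches : iter (toℕ ((d ∸ toℕ k₀) mod d)) f ℓ ≡ i
      reaches = begin
        iter (toℕ ((d ∸ toℕ k₀) mod d)) f ℓ   ≡⟨ cong (λ m → iter m f ℓ) (toℕ-mod-d (d ∸ toℕ k₀)) ⟩
        iter ((d ∸ toℕ k₀) % d) f ℓ           ≡⟨ iter-%d (d ∸ toℕ k₀) ℓ ⟨
        iter (d ∸ toℕ k₀) f ℓ                 ≡⟨ iter-back k₀ i ⟩
        i                                     ∎

  open Decomposition

  opaque
    leaders : List (Fin N)
    leaders = filter isLeader? (allFin N)

    leaders-complete : ∀ {ℓ} → IsLeader ℓ → ℓ ∈ leaders
    leaders-complete {ℓ} = ∈-filter⁺ isLeader? (∈-allFin ℓ)

    leaders-sound : All IsLeader leaders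
    leaders-sound = All.all-filter isLeader? (allFin N)

    leaders-unique : Unique leaders
    leaders-unique = Unique.filter⁺ isLeader? (Unique.allFin⁺ N)

  L : ℕ
  L = length leaders

  rank : ∀ {ℓ} → IsLeader ℓ → Fin L
  rank ℓ-leader = Any.index (leaders-complete ℓ-leader)

  lookup-rank : ∀ {ℓ} (ℓ-leader : IsLeader ℓ) → List.lookup leaders (rank ℓ-leader) ≡ ℓ
  lookup-rank ℓ-leader = sym (Any.lookup-index (leaders-complete ℓ-leader))

  lookup-isLeader : ∀ r → IsLeader (List.lookup leaders r)
  lookup-isLeader r = All.lookup leaders-sound (∈-lookup r)

  rank-unique : ∀ {ℓ} (ℓ-leader : IsLeader ℓ) r → List.lookup leaders r ≡ ℓ → rank ℓ-leader ≡ r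
  rank-unique ℓ-leader r eq = Unique⇒lookup-injective leaders-unique (trans (lookup-rank ℓ-leader) (sym eq))

  encode : Fin N → Fin d × Fin L
  encode i = position (decompose i) , rank (isLeader (decompose i))

  decode : Fin d × Fin L → Fin N
  decode (j , r) = iter (toℕ j) f (List.lookup leaders r)

  decode∘encode : ∀ i → decode (encode i) ≡ i
  decode∘encode i = trans (cong (iter (toℕ (position D)) f) (lookup-rank (isLeader D))) (reaches D)
    where
    D : Decomposition i
    D = decompose i

  encode∘decode : ∀ jr → encode (decode jr) ≡ jr
  encode∘decode (j , r) = cong₂ _,_ (proj₂ same) (rank-unique (isLeader D) r (sym (proj₁ same)))
    where
    D : Decomposition (decode (j , r))
    D = decompose (decode (j , r))
    same : leader D ≡ List.lookup leaders r × position D ≡ j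
    same = decomposition-unique (position D) j (isLeader D) (lookup-isLeader r) (reaches D)

  encode-injective : ∀ {i i′} → encode i ≡ encode i′ → i ≡ i′
  encode-injective {i} {i′} eq = trans (sym (decode∘encode i)) (trans (cong decode eq) (decode∘encode i′))

  decode-injective : ∀ {jr jr′} → decode jr ≡ decode jr′ → jr ≡ jr′
  decode-injective {jr} {jr′} eq = trans (sym (encode∘decode jr)) (trans (cong encode eq) (encode∘decode jr′))

  N≡d*L : N ≡ d * L
  N≡d*L = Fin.cantor-schröder-bernstein {f = uncurry combine ∘ encode} {g = decode ∘ remQuot L}
    (λ eq → encode-injective (combine-injective eq)) (λ eq → remQuot-injective (decode-injective eq))
    where
    combine-injective : ∀ {jr jr′ : Fin d × Fin L} → uncurry combine jr ≡ uncurry combine jr′ → jr ≡ jr′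
    combine-injective {j , r} {j′ , r′} eq = uncurry (cong₂ _,_) (Fin.combine-injective j r j′ r′ eq)
    remQuot-injective : ∀ {c c′ : Fin (d * L)} → remQuot L c ≡ remQuot L c′ → c ≡ c′
    remQuot-injective {c} {c′} eq = trans (sym (Fin.combine-remQuot {d} L c)) (trans (cong (uncurry combine) eq) (Fin.combine-remQuot {d} L c′))

  σ τ : Fin N → Fin N
  σ i = cast (sym N≡d*L) (uncurry combine (encode i))
  τ c = decode (remQuot {d} L (cast N≡d*L c))

  τ∘σ : ∀ i → τ (σ i) ≡ i
  τ∘σ i = begin
    decode (remQuot {d} L (cast N≡d*L (cast (sym N≡d*L) (uncurry combine (encode i))))) ≡⟨ cong (decode ∘ remQuot {d} L) (Fin.cast-involutive N≡d*L (sym N≡d*L) (uncurry combine (encode i))) ⟩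
    decode (remQuot {d} L (uncurry combine (encode i)))                                ≡⟨ cong decode (Fin.remQuot-combine (position (decompose i)) _) ⟩
    decode (encode i)                                                                   ≡⟨ decode∘encode i ⟩
    i                                                                                   ∎
    where open ≡-Reasoning

  σ∘τ : ∀ c → σ (τ c) ≡ c
  σ∘τ c = begin
    cast (sym N≡d*L) (uncurry combine (encode (decode (remQuot {d} L (cast N≡d*L c))))) ≡⟨ cong (cast (sym N≡d*L) ∘ uncurry combine) (encode∘decode (remQuot {d} L (cast N≡d*L c))) ⟩
    cast (sym N≡d*L) (uncurry combine (remQuot {d} L (cast N≡d*L c)))                   ≡⟨ cong (cast (sym N≡d*L)) (Fin.combine-remQuot {d} L (cast N≡d*L c)) ⟩
    cast (sym N≡d*L) (cast N≡d*L c)                                                       ≡⟨ Fin.cast-involutive (sym N≡d*L) N≡d*L c ⟩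
    c                                                                                     ∎
    where open ≡-Reasoning

  toℕ-σ : ∀ i → toℕ (σ i) ≡ L * toℕ (position (decompose i)) + toℕ (rank (isLeader (decompose i)))
  toℕ-σ i = trans (Fin.toℕ-cast (sym N≡d*L) _) (Fin.toℕ-combine (position (decompose i)) _)

  decompose-f : ∀ i → leader (decompose (f i)) ≡ leader (decompose i) × position (decompose (f i)) ≡ suc (toℕ (position (decompose i))) mod d
  decompose-f i = decomposition-unique (position D′) (suc (toℕ j) mod d) (isLeader D′) (isLeader D) (trans (reaches D′) (sym (begin
    iter (toℕ (suc (toℕ j) mod d)) f (leader D)  ≡⟨ cong (λ m → iter m f (leader D)) (toℕ-mod-d (suc (toℕ j))) ⟩
    iter (suc (toℕ j) % d) f (leader D)          ≡⟨ iter-%d (suc (toℕ j)) (leader D) ⟨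
    f (iter (toℕ j) f (leader D))                ≡⟨ cong f (reaches D) ⟩
    f i                                          ∎)))
    where
    open ≡-Reasoning
    D : Decomposition i
    D = decompose i
    D′ : Decomposition (f i)
    D′ = decompose (f i)
    j : Fin d
    j = position D

  -- σ sends fʲ(ℓ) to L j + r, where ℓ is the r-th leader; adding L moves one step along the cycle.
  +L-mod : ∀ j r → j < d → r < L → (L * j + r + L) % N ≡ L * (suc j % d) + r
  +L-mod j r j<d r<L with m≤n⇒m<n∨m≡n j<d
  ... | inj₁ 1+j<d = begin
    (L * j + r + L) % N       ≡⟨ cong (_% N) (rearrange L j r) ⟩
    (L * suc j + r) % N       ≡⟨ m<n⇒m%n≡m bound ⟩
    L * suc j + r             ≡⟨ cong (λ m → L * m + r) (m<n⇒m%n≡m 1+j<d) ⟨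
    L * (suc j % d) + r       ∎
    where
    open ≡-Reasoning
    rearrange : ∀ L j r → L * j + r + L ≡ L * suc j + r
    rearrange = solve-∀
    bound : L * suc j + r < N
    bound = ≤-Reasoning.begin-strict
      L * suc j + r           ≤-Reasoning.<⟨ +-monoʳ-< (L * suc j) r<L ⟩
      L * suc j + L           ≤-Reasoning.≡⟨ trans (+-comm (L * suc j) L) (sym (*-suc L (suc j))) ⟩
      L * suc (suc j)         ≤-Reasoning.≤⟨ *-monoʳ-≤ L 1+j<d ⟩
      L * d                   ≤-Reasoning.≡⟨ trans (*-comm L d) (sym N≡d*L) ⟩
      N                       ≤-Reasoning.∎
  ... | inj₂ 1+j≡d = begin
    (L * j + r + L) % N       ≡⟨ cong (_% N) (rearrange L j r) ⟩
    (r + L * suc j) % N       ≡⟨ cong (λ m → (r + m) % N) (trans (cong (L *_) 1+j≡d) (trans (*-comm L d) (sym N≡d*L))) ⟩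
    (r + N) % N               ≡⟨ [m+n]%n≡m%n r N ⟩
    r % N                     ≡⟨ m<n⇒m%n≡m (<-≤-trans r<L (subst (L ≤_) (sym N≡d*L) (m≤n*m L d))) ⟩
    r                         ≡⟨ trans (cong (λ m → L * m + r) (trans (cong (_% d) 1+j≡d) (n%n≡0 d))) (cong (_+ r) (*-zeroʳ L)) ⟨
    L * (suc j % d) + r       ∎
    where
    open ≡-Reasoning
    rearrange : ∀ L j r → L * j + r + L ≡ r + L * suc j
    rearrange = solve-∀

  σ-conjugates : ∀ i → σ (f i) ≡ σ i ⊕ L mod N
  σ-conjugates i = Fin.toℕ-injective (begin
    toℕ (σ (f i))                                        ≡⟨ toℕ-σ (f i) ⟩
    L * toℕ (position D′) + toℕ (rank (isLeader D′))     ≡⟨ cong₂ (λ m r → L * m + toℕ r) (trans (cong toℕ (proj₂ (decompose-f i))) (toℕ-mod-d (suc (toℕ j)))) same-rank ⟩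
    L * (suc (toℕ j) % d) + toℕ r                        ≡⟨ +L-mod (toℕ j) (toℕ r) (Fin.toℕ<n j) (Fin.toℕ<n r) ⟨
    (L * toℕ j + toℕ r + L) % N                          ≡⟨ cong (λ m → (m + L) % N) (toℕ-σ i) ⟨
    (toℕ (σ i) + L) % N                                  ≡⟨ [m+n%d]%d≡[m+n]%d (toℕ (σ i)) L N ⟨
    (toℕ (σ i) + L % N) % N                              ≡⟨ cong (λ m → (toℕ (σ i) + m) % N) (toℕ-mod L) ⟨
    (toℕ (σ i) + toℕ (L mod N)) % N                      ≡⟨ toℕ-⊕ (σ i) (L mod N) ⟨
    toℕ (σ i ⊕ L mod N)                                  ∎)
    where
    open ≡-Reasoning
    D : Decomposition i
    D = decompose i
    D′ : Decomposition (f i)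
    D′ = decompose (f i)
    j : Fin d
    j = position D
    r : Fin L
    r = rank (isLeader D)
    same-rank : rank (isLeader D′) ≡ r
    same-rank = rank-unique (isLeader D′) r (trans (lookup-rank (isLeader D)) (sym (proj₁ (decompose-f i))))

  conjugation : Permutation′ N
  conjugation = permutation σ τ σ∘τ τ∘σ

Sq-cycleType : ∀ k (p : Permutation′ (suc k)) d m → HasCycleType-d^[n/d] d p → suc k ≡ d * m →
               Sq p ≡ Sq (Rotations.rotation k (m mod suc k))
Sq-cycleType k p zero     m _      N≡0*m = contradiction N≡0*m λ ()
Sq-cycleType k p (suc d′) m p-type N≡d*m = begin
  Sq p                          ≡⟨ Sq-conjugate conjugation {p} {rotation (L mod suc k)} σ-conjugates ⟩
  Sq (rotation (L mod suc k))   ≡⟨ cong (λ l → Sq (rotation (l mod suc k))) (*-cancelˡ-≡ L m (suc d′) (trans (sym N≡d*L) N≡d*m)) ⟩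
  Sq (rotation (m mod suc k))   ∎
  where
  open ≡-Reasoning
  open Rotations k using (rotation)
  open CycleType k (p ⟨$⟩ʳ_) d′ p-type

-- Counting residues by their order

φ≡∑-coprime : ∀ d → φ d ≡ ∑[ q ∈ upTo d ] 𝟙 (gcd q d ℕ.≟ 1)
φ≡∑-coprime d = +-cancelʳ-≡ (𝟙 (gcd d d ℕ.≟ 1)) _ _ (begin
  φ d + 𝟙 (gcd d d ℕ.≟ 1)                                ≡⟨ +-comm (φ d) _ ⟩
  𝟙 (gcd d d ℕ.≟ 1) + φ d                                ≡⟨ cong₂ _+_ (cong (λ g → 𝟙 (g ℕ.≟ 1)) gcd[d,d]≡gcd[0,d]) (length-filter (λ k → gcd (suc k) d ℕ.≟ 1) (upTo d)) ⟩
  𝟙 (gcd 0 d ℕ.≟ 1) + (∑[ k ∈ upTo d ] 𝟙 (gcd (suc k) d ℕ.≟ 1)) ≡⟨ ∑-upTo-suc d (λ q → 𝟙 (gcd q d ℕ.≟ 1)) ⟨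
  ∑[ q ∈ upTo (suc d) ] 𝟙 (gcd q d ℕ.≟ 1)                ≡⟨ ∑-upTo-last d (λ q → 𝟙 (gcd q d ℕ.≟ 1)) ⟩
  (∑[ q ∈ upTo d ] 𝟙 (gcd q d ℕ.≟ 1)) + 𝟙 (gcd d d ℕ.≟ 1) ∎)
  where
  open ≡-Reasoning
  gcd[d,d]≡gcd[0,d] : gcd d d ≡ gcd 0 d
  gcd[d,d]≡gcd[0,d] = trans (∣-antisym (gcd[m,n]∣m d d) (gcd-greatest ∣-refl ∣-refl)) (sym (gcd-identityˡ d))

module Order (N : ℕ) .{{_ : NonZero N}} where

  gcd≢0 : ∀ x → NonZero (gcd x N)
  gcd≢0 x = ≢-nonZero (gcd[m,n]≢0 x N (inj₂ (≢-nonZero⁻¹ N)))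

  order : ℕ → ℕ
  order x = _/_ N (gcd x N) {{gcd≢0 x}}

  N≡gcd*order : ∀ x → N ≡ gcd x N * order x
  N≡gcd*order x = sym (m*[n/m]≡n {{gcd≢0 x}} (gcd[m,n]∣n x N))

  order∣N : ∀ x → order x ∣ N
  order∣N x = divides (gcd x N) (N≡gcd*order x)

  module _ {d m′ : ℕ} (N≡m*d : N ≡ suc m′ * d) where

    private
      m : ℕ
      m = suc m′

    order≡d⇒gcd≡m : ∀ x → order x ≡ d → gcd x N ≡ m
    order≡d⇒gcd≡m x order≡d = *-cancelʳ-≡ (gcd x N) m d {{d≢0}} (trans (cong (gcd x N *_) (sym order≡d)) (trans (sym (N≡gcd*order x)) N≡m*d))
      where
      d≢0 : NonZero d
      d≢0 = ≢-nonZero λ d≡0 → ≢-nonZero⁻¹ N (trans N≡m*d (trans (cong (m *_) d≡0) (*-zeroʳ m)))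

    gcd≡m⇒order≡d : ∀ x → gcd x N ≡ m → order x ≡ d
    gcd≡m⇒order≡d x gcd≡m = *-cancelˡ-≡ (order x) d m (trans (cong (_* order x) (sym gcd≡m)) (trans (sym (N≡gcd*order x)) N≡m*d))

    gcd[qm,N]≡gcd[q,d]*m : ∀ q → gcd (q * m) N ≡ gcd q d * m
    gcd[qm,N]≡gcd[q,d]*m q = begin
      gcd (q * m) N         ≡⟨ cong₂ gcd (*-comm q m) (trans N≡m*d (*-comm m d)) ⟩
      gcd (m * q) (d * m)   ≡⟨ cong (gcd (m * q)) (*-comm d m) ⟩
      gcd (m * q) (m * d)   ≡⟨ c*gcd[m,n]≡gcd[cm,cn] m q d ⟨
      m * gcd q d           ≡⟨ *-comm m (gcd q d) ⟩
      gcd q d * m           ∎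
      where open ≡-Reasoning

    gcd[qm+r,N]≢m : ∀ q r → 0 < r → r < m → gcd (q * m + r) N ≢ m
    gcd[qm+r,N]≢m q r 0<r r<m gcd≡m = <⇒≱ r<m (∣⇒≤ {{>-nonZero 0<r}}
      (∣m+n∣m⇒∣n (subst (_∣ q * m + r) gcd≡m (gcd[m,n]∣m (q * m + r) N)) (n∣m*n q)))

    ∑-𝟙-gcd≡m : ∀ q → ∑[ r ∈ upTo m ] 𝟙 (gcd (q * m + r) N ℕ.≟ m) ≡ 𝟙 (gcd q d ℕ.≟ 1)
    ∑-𝟙-gcd≡m q = begin
      ∑[ r ∈ upTo m ] 𝟙 (gcd (q * m + r) N ℕ.≟ m)                                      ≡⟨ ∑-upTo-suc m′ (λ r → 𝟙 (gcd (q * m + r) N ℕ.≟ m)) ⟩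
      𝟙 (gcd (q * m + 0) N ℕ.≟ m) + (∑[ r ∈ upTo m′ ] 𝟙 (gcd (q * m + suc r) N ℕ.≟ m)) ≡⟨ cong₂ _+_ first rest ⟩
      𝟙 (gcd q d ℕ.≟ 1) + 0                                                            ≡⟨ +-identityʳ _ ⟩
      𝟙 (gcd q d ℕ.≟ 1)                                                                ∎
      where
      open ≡-Reasoning
      gcd[qm+0,N]≡gcd[q,d]*m : gcd (q * m + 0) N ≡ gcd q d * m
      gcd[qm+0,N]≡gcd[q,d]*m = trans (cong (λ x → gcd x N) (+-identityʳ (q * m))) (gcd[qm,N]≡gcd[q,d]*m q)
      first : 𝟙 (gcd (q * m + 0) N ℕ.≟ m) ≡ 𝟙 (gcd q d ℕ.≟ 1)
      first = 𝟙-cong (gcd (q * m + 0) N ℕ.≟ m) (gcd q d ℕ.≟ 1)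
        (λ eq → *-cancelʳ-≡ (gcd q d) 1 m (trans (sym gcd[qm+0,N]≡gcd[q,d]*m) (trans eq (sym (*-identityˡ m)))))
        (λ eq → trans gcd[qm+0,N]≡gcd[q,d]*m (trans (cong (_* m) eq) (*-identityˡ m)))
      rest : ∑[ r ∈ upTo m′ ] 𝟙 (gcd (q * m + suc r) N ℕ.≟ m) ≡ 0
      rest = ∑-𝟙-none (λ r → gcd (q * m + suc r) N ℕ.≟ m)
        (All.applyUpTo⁺₁ (λ r → r) m′ λ {r} r<m′ → gcd[qm+r,N]≢m q (suc r) (s≤s z≤n) (s≤s r<m′))

    ∑-𝟙-order≡divisor : ∑[ x ∈ upTo N ] 𝟙 (order x ℕ.≟ d) ≡ φ d
    ∑-𝟙-order≡divisor = begin
      ∑[ x ∈ upTo N ] 𝟙 (order x ℕ.≟ d)                         ≡⟨ ∑-cong (upTo N) (λ x → 𝟙-cong (order x ℕ.≟ d) (gcd x N ℕ.≟ m) (order≡d⇒gcd≡m x) (gcd≡m⇒order≡d x)) ⟩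
      ∑[ x ∈ upTo N ] 𝟙 (gcd x N ℕ.≟ m)                         ≡⟨ cong (λ n → ∑[ x ∈ upTo n ] 𝟙 (gcd x N ℕ.≟ m)) (trans N≡m*d (*-comm m d)) ⟩
      ∑[ x ∈ upTo (d * m) ] 𝟙 (gcd x N ℕ.≟ m)                   ≡⟨ ∑-upTo-* d m (λ x → 𝟙 (gcd x N ℕ.≟ m)) ⟩
      ∑[ q ∈ upTo d ] ∑[ r ∈ upTo m ] 𝟙 (gcd (q * m + r) N ℕ.≟ m) ≡⟨ ∑-cong (upTo d) ∑-𝟙-gcd≡m ⟩
      ∑[ q ∈ upTo d ] 𝟙 (gcd q d ℕ.≟ 1)                         ≡⟨ φ≡∑-coprime d ⟨
      φ d                                                       ∎
      where open ≡-Reasoning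

  ∑-𝟙-order≡ : ∀ d → ∑[ x ∈ upTo N ] 𝟙 (order x ℕ.≟ d) ≡ 𝟙 (d ∣? N) * φ d
  ∑-𝟙-order≡ d with d ∣? N
  ... | no d∤N = ∑-𝟙-none (λ x → order x ℕ.≟ d) (All.applyUpTo⁺₁ (λ x → x) N λ {x} _ order≡d → d∤N (subst (_∣ N) order≡d (order∣N x)))
  ... | yes (divides zero N≡0) = contradiction N≡0 (≢-nonZero⁻¹ N)
  ... | yes (divides (suc m′) N≡m*d) = trans (∑-𝟙-order≡divisor {d} {m′} N≡m*d) (sym (+-identityʳ (φ d)))

  ∑-order : ∀ (F : ℕ → ℕ) → ∑[ x ∈ upTo N ] F (order x) ≡ ∑[ d ∈ divisors N ] φ d * F d
  ∑-order F = begin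
    ∑[ x ∈ upTo N ] F (order x)
      ≡⟨ ∑-cong (upTo N) (λ x → ∑-δ ℕ._≟_ (upTo (suc N)) (order x) (∑-upTo-𝟙[c≟x]≡1 (s≤s (∣⇒≤ (order∣N x)))) F) ⟨
    ∑[ x ∈ upTo N ] ∑[ d ∈ upTo (suc N) ] 𝟙 (order x ℕ.≟ d) * F d
      ≡⟨ ∑-comm (upTo N) (upTo (suc N)) _ ⟩
    ∑[ d ∈ upTo (suc N) ] ∑[ x ∈ upTo N ] 𝟙 (order x ℕ.≟ d) * F d
      ≡⟨ ∑-cong (upTo (suc N)) (λ d → trans (sym (*-distribʳ-∑ (F d) (upTo N) (λ x → 𝟙 (order x ℕ.≟ d)))) (cong (_* F d) (∑-𝟙-order≡ d))) ⟩
    ∑[ d ∈ upTo (suc N) ] 𝟙 (d ∣? N) * φ d * F d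
      ≡⟨ ∑-upTo-suc N (λ d → 𝟙 (d ∣? N) * φ d * F d) ⟩
    𝟙 (0 ∣? N) * φ 0 * F 0 + (∑[ d ∈ upTo N ] 𝟙 (suc d ∣? N) * φ (suc d) * F (suc d))
      ≡⟨ cong₂ _+_ (cong (λ b → b * φ 0 * F 0) (𝟙-no (0 ∣? N) (≢-nonZero⁻¹ N ∘ 0∣⇒≡0)))
                   (∑-cong (upTo N) (λ d → *-assoc (𝟙 (suc d ∣? N)) (φ (suc d)) (F (suc d)))) ⟩
    ∑[ d ∈ upTo N ] 𝟙 (suc d ∣? N) * (φ (suc d) * F (suc d))
      ≡⟨ ∑-map suc (upTo N) (λ d → 𝟙 (d ∣? N) * (φ d * F d)) ⟨
    ∑[ d ∈ map suc (upTo N) ] 𝟙 (d ∣? N) * (φ d * F d)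
      ≡⟨ ∑-filter (_∣? N) (map suc (upTo N)) (λ d → φ d * F d) ⟨
    ∑[ d ∈ divisors N ] φ d * F d
      ∎
    where open ≡-Reasoning

  order∣⇒N∣* : ∀ x j → order x ∣ j → N ∣ j * x
  order∣⇒N∣* x j (divides c j≡c*o) = divides (c * (x / g)) (begin
    j * x                         ≡⟨ cong₂ _*_ j≡c*o (sym (m/n*n≡m (gcd[m,n]∣m x N))) ⟩
    c * order x * (x / g * g)     ≡⟨ rearrange c (order x) (x / g) g ⟩
    c * (x / g) * (g * order x)   ≡⟨ cong (c * (x / g) *_) (N≡gcd*order x) ⟨
    c * (x / g) * N               ∎)
    where
    open ≡-Reasoning
    g : ℕ
    g = gcd x N
    instance
      g≢0 : NonZero g
      g≢0 = gcd≢0 x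
    rearrange : ∀ c o u g → c * o * (u * g) ≡ c * u * (g * o)
    rearrange = solve-∀

  N∣*⇒order∣ : ∀ x j → N ∣ j * x → order x ∣ j
  N∣*⇒order∣ x j (divides c j*x≡c*N) = Coprime.coprime-divisor (Coprime.sym (Coprime.coprime-/gcd x N))
    (*-cancelʳ-∣ g (divides c (begin
      x / g * j * g             ≡⟨ rearrange (x / g) j g ⟩
      j * (x / g * g)           ≡⟨ cong (j *_) (m/n*n≡m (gcd[m,n]∣m x N)) ⟩
      j * x                     ≡⟨ j*x≡c*N ⟩
      c * N                     ≡⟨ cong (c *_) (trans (N≡gcd*order x) (*-comm g (order x))) ⟩
      c * (order x * g)         ∎)))
    where
    open ≡-Reasoning
    g : ℕ
    g = gcd x N
    instance
      g≢0 : NonZero g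
      g≢0 = gcd≢0 x
    rearrange : ∀ u j g → u * j * g ≡ j * (u * g)
    rearrange = solve-∀

module RotationCycles (k : ℕ) where
  open Rotations k
  open Order N

  toℕ-iter-⊕ : ∀ a j i → toℕ (iter j (_⊕ a) i) ≡ (toℕ i + j * toℕ a) % N
  toℕ-iter-⊕ a zero    i = trans (sym (toℕ%N i)) (cong (_% N) (sym (+-identityʳ (toℕ i))))
  toℕ-iter-⊕ a (suc j) i = begin
    toℕ (iter j (_⊕ a) i ⊕ a)                  ≡⟨ toℕ-⊕ (iter j (_⊕ a) i) a ⟩
    (toℕ (iter j (_⊕ a) i) + toℕ a) % N        ≡⟨ cong (λ m → (m + toℕ a) % N) (toℕ-iter-⊕ a j i) ⟩
    ((toℕ i + j * toℕ a) % N + toℕ a) % N      ≡⟨ [m%d+n]%d≡[m+n]%d (toℕ i + j * toℕ a) (toℕ a) N ⟩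
    (toℕ i + j * toℕ a + toℕ a) % N            ≡⟨ cong (_% N) (trans (+-assoc (toℕ i) (j * toℕ a) (toℕ a)) (cong (toℕ i +_) (+-comm (j * toℕ a) (toℕ a)))) ⟩
    (toℕ i + suc j * toℕ a) % N                ∎
    where open ≡-Reasoning

  iter-⊕-fixed⇒ : ∀ a j i → iter j (_⊕ a) i ≡ i → N ∣ j * toℕ a
  iter-⊕-fixed⇒ a j i fixed = divides ((toℕ i + j * toℕ a) / N) (+-cancelˡ-≡ (toℕ i) _ _ (begin
    toℕ i + j * toℕ a                                         ≡⟨ m≡m%n+[m/n]*n (toℕ i + j * toℕ a) N ⟩
    (toℕ i + j * toℕ a) % N + (toℕ i + j * toℕ a) / N * N     ≡⟨ cong (_+ (toℕ i + j * toℕ a) / N * N) (trans (sym (toℕ-iter-⊕ a j i)) (cong toℕ fixed)) ⟩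
    toℕ i + (toℕ i + j * toℕ a) / N * N                       ∎))
    where open ≡-Reasoning

  iter-⊕-fixed⇐ : ∀ a j i → N ∣ j * toℕ a → iter j (_⊕ a) i ≡ i
  iter-⊕-fixed⇐ a j i (divides c j*a≡c*N) = Fin.toℕ-injective (begin
    toℕ (iter j (_⊕ a) i)       ≡⟨ toℕ-iter-⊕ a j i ⟩
    (toℕ i + j * toℕ a) % N     ≡⟨ cong (λ m → (toℕ i + m) % N) j*a≡c*N ⟩
    (toℕ i + c * N) % N         ≡⟨ [m+kn]%n≡m%n (toℕ i) c N ⟩
    toℕ i % N                   ≡⟨ toℕ%N i ⟩
    toℕ i                       ∎)
    where open ≡-Reasoning

  rotation-cycleType : ∀ a → HasCycleType-d^[n/d] (order (toℕ a)) (rotation a)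
  rotation-cycleType a i = iter-⊕-fixed⇐ a (order (toℕ a)) i (order∣⇒N∣* (toℕ a) (order (toℕ a)) ∣-refl) ,
    λ j 0<j j<order fixed → <⇒≱ j<order (∣⇒≤ {{>-nonZero 0<j}} (N∣*⇒order∣ (toℕ a) j (iter-⊕-fixed⇒ a j i fixed)))

proposition3 : (n : ℕ) .{{_ : NonZero n}} → 2 ≤ n →
    (g : ℕ → Permutation′ n) → (∀ d → d ∣ n → HasCycleType-d^[n/d] d (g d)) →
    ∃[ rs ] (IsRepSystemΘ n rs × n * length rs ≡ rhsSum n g)
proposition3 (suc k) _ g g-type = representatives , representatives-isRepSystem , (begin
  N * length representatives                 ≡⟨ N*|representatives|≡∑Sq ⟩
  ∑[ a ∈ allFin N ] Sq (rotation a)          ≡⟨ ∑-cong (allFin N) Sq-rotation ⟩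
  ∑[ a ∈ allFin N ] Sq (g (order (toℕ a)))   ≡⟨ ∑-upTo≡∑-allFin N (Sq ∘ g ∘ order) ⟨
  ∑[ x ∈ upTo N ] Sq (g (order x))           ≡⟨ ∑-order (Sq ∘ g) ⟩
  rhsSum N g                                 ∎)
  where
  open ≡-Reasoning
  open Rotations k
  open RepresentativeSystem k
  open Order N
  open RotationCycles k
  Sq-rotation : ∀ a → Sq (rotation a) ≡ Sq (g (order (toℕ a)))
  Sq-rotation a = trans (Sq-cycleType k (rotation a) (order x) (gcd x N) (rotation-cycleType a) N≡order*gcd)
    (sym (Sq-cycleType k (g (order x)) (order x) (gcd x N) (g-type (order x) (order∣N x)) N≡order*gcd))
    where
    x : ℕ
    x = toℕ a
    N≡order*gcd : N ≡ order x * gcd x N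
    N≡order*gcd = trans (N≡gcd*order x) (*-comm (gcd x N) (order x))
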